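{- Let $q=(1+uy)/(1+y)$ and for $n\ge0$ let $a_n(u,y)=\sum_D u^{\operatorname{des}(D)}y^{e(D)}$, the sum over all acyclic digraphs $D$ on $[n]$. Then for every $n\ge1$, \[a_n(u,y)=\sum_{i=0}^{n-1}(-1)^{n-i-1}\binom ni_q(1+y)^{i(n-i)}a_i(u,y).\]
   Context: A digraph on a finite set $V$ of integers is a set $E\subseteq V\times V$ of ordered pairs $(s,t)$ with $s\ne t$ (edges); it is acyclic if it has no nonempty directed path from a vertex to itself. $e(D)$ is the number of edges and $\operatorname{des}(D)$ the number of descents (edges $(s,t)$ with $s>t$). $a_0=1$ (empty digraph). $n!_q=\prod_{k=1}^n(1+q+\cdots+q^{k-1})$, $\binom ni_q=\frac{n!_q}{i!_q(n-i)!_q}$. -}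

module Defs where

open import Data.Nat as ℕ using (ℕ; zero; suc; _∸_)
open import Data.Fin as Fin using (Fin; toℕ)
open import Data.Fin.Properties using () renaming (_≟_ to _≟ᶠ_)
open import Data.Bool using (Bool; true; false; _∧_; _∨_; not; if_then_else_)
open import Data.List as List using (List; []; _∷_; _++_; map; filter; concatMap; allFin; upTo; foldr; length)
open import Data.Product using (_×_; _,_; proj₁; proj₂)
open import Data.Rational using (ℚ; 0ℚ; 1ℚ; _+_; _*_; -_; _÷_; ≢-nonZero)
open import Data.Rational.Properties using () renaming (_≟_ to _≟ℚ_)
open import Relation.Nullary using (yes; no; ¬_)
open import Relation.Nullary.Decidable using (⌊_⌋)

pow : ℚ → ℕ → ℚ
pow x zero    = 1ℚ
pow x (suc k) = x * pow x k

-- total division (x / 0 := 0); only used where the denominator is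
-- assumed nonzero in the theorem's hypotheses
div : ℚ → ℚ → ℚ
div x y with y ≟ℚ 0ℚ
... | yes _  = 0ℚ
... | no y≢0 = _÷_ x y {{≢-nonZero y≢0}}

sumℚ : List ℚ → ℚ
sumℚ = foldr _+_ 0ℚ

sumBelow : ℕ → (ℕ → ℚ) → ℚ
sumBelow n f = sumℚ (map f (upTo n))

qint : ℚ → ℕ → ℚ
qint q k = sumBelow k (pow q)

qfact : ℚ → ℕ → ℚ
qfact q zero    = 1ℚ
qfact q (suc n) = qint q (suc n) * qfact q n

qbinom : ℚ → ℕ → ℕ → ℚ
qbinom q n i = div (qfact q n) (qfact q i * qfact q (n ∸ i))

-- Digraphs on [n], modelled as vertex set Fin n (vertex k ↔ k+1, so the
-- order of vertices is preserved).

Edge : ℕ → Set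
Edge n = Fin n × Fin n

allEdges : (n : ℕ) → List (Edge n)
allEdges n = concatMap (λ s → map (λ t → (s , t))
                                   (filter (λ t → ¬? (s ≟ᶠ t)) (allFin n)))
                       (allFin n)
  where
  open import Relation.Nullary.Decidable using (¬?)

subsets : {A : Set} → List A → List (List A)
subsets []       = [] ∷ []
subsets (x ∷ xs) = let r = subsets xs in map (x ∷_) r ++ r

-- a digraph on [n] is a set of edges, i.e. a sublist of allEdges n;
-- all digraphs on [n] (each exactly once):
digraphs : (n : ℕ) → List (List (Edge n))
digraphs n = subsets (allEdges n)

hasEdge : {n : ℕ} → List (Edge n) → Fin n → Fin n → Bool
hasEdge []             s t = false
hasEdge ((a , b) ∷ es) s t = (⌊ a ≟ᶠ s ⌋ ∧ ⌊ b ≟ᶠ t ⌋) ∨ hasEdge es s t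

anyFin : (n : ℕ) → (Fin n → Bool) → Bool
anyFin n p = foldr (λ v b → p v ∨ b) false (allFin n)

-- walk E k s t : there is a directed walk s → t with exactly (suc k) edges
walk : {n : ℕ} → List (Edge n) → ℕ → Fin n → Fin n → Bool
walk {n} E zero    s t = hasEdge E s t
walk {n} E (suc k) s t = anyFin n (λ v → hasEdge E s v ∧ walk E k v t)

-- acyclic: no nonempty closed directed walk (equivalently, no directed
-- cycle); a closed walk exists iff one of length ≤ n exists, so lengths
-- 1..n are checked.
acyclic : {n : ℕ} → List (Edge n) → Bool
acyclic {n} E = not (anyFin n (λ s → foldr (λ k b → walk E k s s ∨ b) false (upTo n)))

e : {n : ℕ} → List (Edge n) → ℕ
e = length

des : {n : ℕ} → List (Edge n) → ℕ
des E = length (filter (λ st → toℕ (proj₂ st) ℕ.<? toℕ (proj₁ st)) E)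

a : ℕ → ℚ → ℚ → ℚ
a n u y = sumℚ (map (λ D → if acyclic D then pow u (des D) * pow y (e D) else 0ℚ)
                    (digraphs n))

qOf : ℚ → ℚ → ℚ
qOf u y = div (1ℚ + u * y) (1ℚ + y)

-- Write a(X) for the sum defining a_n taken over the acyclic digraphs inside a vertex set X.
-- An acyclic digraph on a nonempty X has a source, so summing (-1)^|S| over the sets S of its
-- sources gives 0.  Exchanging the two sums, a set S ⊆ X contributes (-1)^|S| a(X ∖ S) times
-- the product of (1 + w e) over the edges e from S to X ∖ S (w e = u y on a descent, y otherwise):
-- once no edge enters S, the edges leaving it are free.  Grouping by i = |X ∖ S| gives
-- a(X) = - Σ_{i<|X|} γ_{|X|,i} a_i, so a(X) depends only on |X|.  Peeling off the least vertex
-- gives a Pascal-type recursion for γ which, writing 1 + u y = q (1 + y), is the q-Pascal rule;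
-- hence γ_{m,i} = (-1)^(m-i) binom(m,i)_q (1 + y)^(i(m-i)).

module Submission where

open import Defs
open import Data.Nat using (ℕ; suc; _∸_; _*_; _<_; _≤_)
open import Data.Rational using (ℚ; 0ℚ; 1ℚ; _+_; -_) renaming (_*_ to _·_)
open import Relation.Binary.PropositionalEquality using (_≡_; _≢_)

open import Data.Nat using (zero)

open import Data.Bool using (Bool; true; false; _∧_; _∨_; not; if_then_else_; T)
open import Data.Bool.ListAction using (all)
open import Data.Bool.Properties using (∨-zeroʳ; ∧-zeroʳ; ∧-identityʳ; not-injective)
open import Data.Empty using (⊥-elim)
open import Data.Fin using (Fin; toℕ) renaming (zero to fz; suc to fs)
open import Data.Fin.Properties using (pigeonhole; toℕ<n) renaming (_≟_ to _≟ᶠ_)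
open import Data.List using (List; []; _∷_; _++_; map; foldr; concatMap; filter; filterᵇ; length; tabulate; allFin; upTo)
open import Data.List.Membership.Propositional using (_∈_)
open import Data.List.Membership.Propositional.Properties using (∈-allFin; ∈-upTo⁺)
open import Data.List.Properties using (map-applyUpTo; upTo-∷ʳ)
open import Data.List.Relation.Unary.Any using (here; there)
open import Data.Nat.Induction using (<-rec)
open import Data.Product using (Σ; _×_; _,_; proj₁; proj₂; ∃-syntax)
open import Data.Rational using (1/_; ≢-nonZero)
open import Data.Rational.Properties using () renaming (_≟_ to _≟ℚ_)
open import Data.Rational.Solver using (module +-*-Solver)
open import Data.Sum using (inj₁; inj₂)
open import Data.Unit using (tt)
open import Data.Vec.Functional using (Vector; head; tail) renaming ([] to []ᵛ; _∷_ to _∷ᵛ_)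
open import Function using (_∘_)
open import Level using (0ℓ)
open import Relation.Binary.Definitions using (tri<; tri≈; tri>)
open import Relation.Binary.PropositionalEquality using (refl; sym; trans; cong; cong₂; subst; module ≡-Reasoning)
open import Relation.Nullary using (does; yes; no; contradiction)
open import Relation.Nullary.Decidable using (⌊_⌋; ¬?; T?; dec-true; dec-false)
open import Relation.Unary using (Pred; Decidable)
import Data.Nat as ℕ
import Data.Nat.Properties as ℕ
import Data.Rational.Properties as ℚ
open +-*-Solver using (solve; _:+_; _:*_; :-_; _:=_; con)

sumOver : {A : Set} → (A → ℚ) → List A → ℚ
sumOver f xs = sumℚ (map f xs)

prodOver : {A : Set} → (A → ℚ) → List A → ℚ
prodOver f = foldr (λ x r → f x · r) 1ℚ

sumOver-++ : {A : Set} (f : A → ℚ) (xs ys : List A) → sumOver f (xs ++ ys) ≡ sumOver f xs + sumOver f ys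
sumOver-++ f []       ys = sym (ℚ.+-identityˡ _)
sumOver-++ f (x ∷ xs) ys = trans (cong (f x +_) (sumOver-++ f xs ys)) (sym (ℚ.+-assoc (f x) _ _))

sumOver-map : {A B : Set} (f : B → ℚ) (g : A → B) (xs : List A) → sumOver f (map g xs) ≡ sumOver (f ∘ g) xs
sumOver-map f g []       = refl
sumOver-map f g (x ∷ xs) = cong (f (g x) +_) (sumOver-map f g xs)

sumOver-cong : {A : Set} {f g : A → ℚ} → (∀ x → f x ≡ g x) → (xs : List A) → sumOver f xs ≡ sumOver g xs
sumOver-cong f≗g []       = refl
sumOver-cong f≗g (x ∷ xs) = cong₂ _+_ (f≗g x) (sumOver-cong f≗g xs)

sumOver-*ˡ : {A : Set} (c : ℚ) (f : A → ℚ) (xs : List A) → sumOver (λ x → c · f x) xs ≡ c · sumOver f xs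
sumOver-*ˡ c f []       = sym (ℚ.*-zeroʳ c)
sumOver-*ˡ c f (x ∷ xs) = trans (cong (c · f x +_) (sumOver-*ˡ c f xs)) (sym (ℚ.*-distribˡ-+ c (f x) _))

sumOver-0 : {A : Set} (xs : List A) → sumOver (λ _ → 0ℚ) xs ≡ 0ℚ
sumOver-0 []       = refl
sumOver-0 (x ∷ xs) = trans (ℚ.+-identityˡ _) (sumOver-0 xs)

sumOver-+ : {A : Set} (f g : A → ℚ) (xs : List A) → sumOver (λ x → f x + g x) xs ≡ sumOver f xs + sumOver g xs
sumOver-+ f g []       = refl
sumOver-+ f g (x ∷ xs) = trans (cong (f x + g x +_) (sumOver-+ f g xs))
  (solve 4 (λ a b c d → (a :+ b) :+ (c :+ d) := (a :+ c) :+ (b :+ d)) refl (f x) (g x) (sumOver f xs) (sumOver g xs))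

sumOver-neg : {A : Set} (f : A → ℚ) (xs : List A) → sumOver (λ x → - f x) xs ≡ - sumOver f xs
sumOver-neg f []       = refl
sumOver-neg f (x ∷ xs) = trans (cong (- f x +_) (sumOver-neg f xs)) (sym (ℚ.neg-distrib-+ (f x) _))

sumOver-comm : {A B : Set} (f : A → B → ℚ) (xs : List A) (ys : List B) →
  sumOver (λ x → sumOver (f x) ys) xs ≡ sumOver (λ y → sumOver (λ x → f x y) xs) ys
sumOver-comm f []       ys = sym (sumOver-0 ys)
sumOver-comm f (x ∷ xs) ys = trans (cong (sumOver (f x) ys +_) (sumOver-comm f xs ys))
  (sym (sumOver-+ (f x) (λ y → sumOver (λ x′ → f x′ y) xs) ys))

prodOver-++ : {A : Set} (f : A → ℚ) (xs ys : List A) → prodOver f (xs ++ ys) ≡ prodOver f xs · prodOver f ys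
prodOver-++ f []       ys = sym (ℚ.*-identityˡ _)
prodOver-++ f (x ∷ xs) ys = trans (cong (f x ·_) (prodOver-++ f xs ys)) (sym (ℚ.*-assoc (f x) _ _))

prodOver-map : {A B : Set} (f : B → ℚ) (g : A → B) (xs : List A) → prodOver f (map g xs) ≡ prodOver (f ∘ g) xs
prodOver-map f g []       = refl
prodOver-map f g (x ∷ xs) = cong (f (g x) ·_) (prodOver-map f g xs)

prodOver-cong : {A : Set} {f g : A → ℚ} → (∀ x → f x ≡ g x) → (xs : List A) → prodOver f xs ≡ prodOver g xs
prodOver-cong f≗g []       = refl
prodOver-cong f≗g (x ∷ xs) = cong₂ _·_ (f≗g x) (prodOver-cong f≗g xs)

prodOver-concatMap : {A B : Set} (f : B → ℚ) (g : A → List B) (xs : List A) →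
  prodOver f (concatMap g xs) ≡ prodOver (λ x → prodOver f (g x)) xs
prodOver-concatMap f g []       = refl
prodOver-concatMap f g (x ∷ xs) =
  trans (prodOver-++ f (g x) (concatMap g xs)) (cong (prodOver f (g x) ·_) (prodOver-concatMap f g xs))

prodOver-filter : {A : Set} {P : Pred A 0ℓ} (P? : Decidable P) (f : A → ℚ) (xs : List A) →
  prodOver f (filter P? xs) ≡ prodOver (λ x → if does (P? x) then f x else 1ℚ) xs
prodOver-filter P? f []       = refl
prodOver-filter P? f (x ∷ xs) with does (P? x)
... | true  = cong (f x ·_) (prodOver-filter P? f xs)
... | false = trans (prodOver-filter P? f xs) (sym (ℚ.*-identityˡ _))

prodOver-filterᵇ : {A : Set} (p : A → Bool) (f : A → ℚ) (xs : List A) →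
  prodOver f (filterᵇ p xs) ≡ prodOver (λ x → if p x then f x else 1ℚ) xs
prodOver-filterᵇ p = prodOver-filter (T? ∘ p)

prodOver-partition : {A : Set} (f : A → ℚ) (p : A → Bool) (xs : List A) →
  prodOver f xs ≡ prodOver f (filterᵇ p xs) · prodOver f (filterᵇ (not ∘ p) xs)
prodOver-partition f p []       = refl
prodOver-partition f p (x ∷ xs) with p x
... | true  = trans (cong (f x ·_) (prodOver-partition f p xs)) (sym (ℚ.*-assoc (f x) _ _))
... | false = trans (cong (f x ·_) (prodOver-partition f p xs))
  (solve 3 (λ a b c → a :* (b :* c) := b :* (a :* c)) refl (f x) (prodOver f (filterᵇ p xs)) _)

pow·pow≡prodOver : {A : Set} {P : Pred A 0ℓ} (P? : Decidable P) (a b : ℚ) (xs : List A) →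
  pow a (length (filter P? xs)) · pow b (length xs) ≡ prodOver (λ x → if does (P? x) then a · b else b) xs
pow·pow≡prodOver P? a b []       = ℚ.*-identityˡ 1ℚ
pow·pow≡prodOver P? a b (x ∷ xs) with does (P? x)
... | true  = trans (solve 4 (λ a b p q → (a :* p) :* (b :* q) := (a :* b) :* (p :* q)) refl a b
                      (pow a (length (filter P? xs))) (pow b (length xs)))
                    (cong (a · b ·_) (pow·pow≡prodOver P? a b xs))
... | false = trans (solve 3 (λ b p q → p :* (b :* q) := b :* (p :* q)) refl b
                      (pow a (length (filter P? xs))) (pow b (length xs)))
                    (cong (b ·_) (pow·pow≡prodOver P? a b xs))

prodFin : (n : ℕ) → (Fin n → ℚ) → ℚ
prodFin zero    g = 1ℚ
prodFin (suc n) g = g fz · prodFin n (g ∘ fs)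

prodOver-tabulate : {A : Set} {n : ℕ} (f : A → ℚ) (g : Fin n → A) → prodOver f (tabulate g) ≡ prodFin n (f ∘ g)
prodOver-tabulate {n = zero}  f g = refl
prodOver-tabulate {n = suc n} f g = cong (f (g fz) ·_) (prodOver-tabulate f (g ∘ fs))

prodFin-cong : {n : ℕ} {f g : Fin n → ℚ} → (∀ v → f v ≡ g v) → prodFin n f ≡ prodFin n g
prodFin-cong {zero}  f≗g = refl
prodFin-cong {suc n} f≗g = cong₂ _·_ (f≗g fz) (prodFin-cong (f≗g ∘ fs))

prodFin-zero : {n : ℕ} (g : Fin n → ℚ) (v : Fin n) → g v ≡ 0ℚ → prodFin n g ≡ 0ℚ
prodFin-zero {suc n} g fz     gv≡0 = trans (cong (_· prodFin n (g ∘ fs)) gv≡0) (ℚ.*-zeroˡ (prodFin n (g ∘ fs)))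
prodFin-zero {suc n} g (fs v) gv≡0 = trans (cong (g fz ·_) (prodFin-zero (g ∘ fs) v gv≡0)) (ℚ.*-zeroʳ (g fz))

prodFin-one : {n : ℕ} {g : Fin n → ℚ} → (∀ v → g v ≡ 1ℚ) → prodFin n g ≡ 1ℚ
prodFin-one {zero}  g≡1 = refl
prodFin-one {suc n} g≡1 = trans (cong₂ _·_ (g≡1 fz) (prodFin-one (g≡1 ∘ fs))) (ℚ.*-identityˡ 1ℚ)

prodFin-· : {n : ℕ} (f g : Fin n → ℚ) → prodFin n (λ v → f v · g v) ≡ prodFin n f · prodFin n g
prodFin-· {zero}  f g = refl
prodFin-· {suc n} f g = trans (cong (f fz · g fz ·_) (prodFin-· (f ∘ fs) (g ∘ fs)))
  (solve 4 (λ a b c d → (a :* b) :* (c :* d) := (a :* c) :* (b :* d)) refl (f fz) (g fz) _ _)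

δ : ℕ → ℕ → ℚ
δ c i = if c ℕ.≡ᵇ i then 1ℚ else 0ℚ

δ-subst : (f : ℕ → ℚ) (t : ℚ) (c i : ℕ) → f c · (t · δ c i) ≡ f i · (t · δ c i)
δ-subst f t c i with c ℕ.≡ᵇ i in c≡ᵇi
... | true  rewrite ℕ.≡ᵇ⇒≡ c i (subst T (sym c≡ᵇi) tt) = refl
... | false = trans (vanish (f c)) (sym (vanish (f i)))
  where
  vanish : ∀ a → a · (t · 0ℚ) ≡ 0ℚ
  vanish a = trans (cong (a ·_) (ℚ.*-zeroʳ t)) (ℚ.*-zeroʳ a)

sumBelow-suc : (m : ℕ) (f : ℕ → ℚ) → sumBelow (suc m) f ≡ f 0 + sumBelow m (f ∘ suc)
sumBelow-suc m f = cong (f 0 +_) (trans (cong (sumOver f) (sym (map-applyUpTo (λ i → i) suc m))) (sumOver-map f suc (upTo m)))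

sumBelow-snoc : (m : ℕ) (f : ℕ → ℚ) → sumBelow (suc m) f ≡ sumBelow m f + f m
sumBelow-snoc m f = trans (cong (sumOver f) (sym (upTo-∷ʳ m)))
  (trans (sumOver-++ f (upTo m) (m ∷ [])) (cong (sumBelow m f +_) (ℚ.+-identityʳ (f m))))

sumBelow-cong : (m : ℕ) {f g : ℕ → ℚ} → (∀ i → i < m → f i ≡ g i) → sumBelow m f ≡ sumBelow m g
sumBelow-cong zero    f≗g = refl
sumBelow-cong (suc m) {f} {g} f≗g = trans (sumBelow-suc m f) (trans
  (cong₂ _+_ (f≗g 0 (ℕ.s≤s ℕ.z≤n)) (sumBelow-cong m (λ i i<m → f≗g (suc i) (ℕ.s≤s i<m))))
  (sym (sumBelow-suc m g)))

sumBelow-δ : (m c : ℕ) → c < m → (g : ℕ → ℚ) → sumBelow m (λ i → δ c i · g i) ≡ g c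
sumBelow-δ (suc m) zero    _ g = begin
    sumBelow (suc m) (λ i → δ 0 i · g i)
  ≡⟨ sumBelow-suc m (λ i → δ 0 i · g i) ⟩
    1ℚ · g 0 + sumOver (λ i → 0ℚ · g (suc i)) (upTo m)
  ≡⟨ cong (1ℚ · g 0 +_) (trans (sumOver-cong (λ i → ℚ.*-zeroˡ (g (suc i))) (upTo m)) (sumOver-0 (upTo m))) ⟩
    1ℚ · g 0 + 0ℚ
  ≡⟨ trans (ℚ.+-identityʳ _) (ℚ.*-identityˡ (g 0)) ⟩
    g 0 ∎
  where open ≡-Reasoning
sumBelow-δ (suc m) (suc c) (ℕ.s≤s c<m) g = begin
    sumBelow (suc m) (λ i → δ (suc c) i · g i)
  ≡⟨ sumBelow-suc m (λ i → δ (suc c) i · g i) ⟩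
    0ℚ · g 0 + sumBelow m (λ i → δ c i · g (suc i))
  ≡⟨ cong₂ _+_ (ℚ.*-zeroˡ (g 0)) (sumBelow-δ m c c<m (g ∘ suc)) ⟩
    0ℚ + g (suc c)
  ≡⟨ ℚ.+-identityˡ _ ⟩
    g (suc c) ∎
  where open ≡-Reasoning

sumBelow-+-vanishing : (m k : ℕ) (f : ℕ → ℚ) → (∀ j → f (m ℕ.+ j) ≡ 0ℚ) → sumBelow (m ℕ.+ k) f ≡ sumBelow m f
sumBelow-+-vanishing m zero    f vanish = cong (λ l → sumBelow l f) (ℕ.+-identityʳ m)
sumBelow-+-vanishing m (suc k) f vanish = begin
    sumBelow (m ℕ.+ suc k) f
  ≡⟨ cong (λ l → sumBelow l f) (ℕ.+-suc m k) ⟩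
    sumBelow (suc (m ℕ.+ k)) f
  ≡⟨ sumBelow-snoc (m ℕ.+ k) f ⟩
    sumBelow (m ℕ.+ k) f + f (m ℕ.+ k)
  ≡⟨ cong₂ _+_ (sumBelow-+-vanishing m k f vanish) (vanish k) ⟩
    sumBelow m f + 0ℚ
  ≡⟨ ℚ.+-identityʳ _ ⟩
    sumBelow m f ∎
  where open ≡-Reasoning

filterᵇ-accept : {A : Set} (p : A → Bool) {x : A} (xs : List A) → p x ≡ true → filterᵇ p (x ∷ xs) ≡ x ∷ filterᵇ p xs
filterᵇ-accept p {x} xs px with p x
... | true = refl

filterᵇ-reject : {A : Set} (p : A → Bool) {x : A} (xs : List A) → p x ≡ false → filterᵇ p (x ∷ xs) ≡ filterᵇ p xs
filterᵇ-reject p {x} xs px with p x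
... | false = refl

filterᵇ-all : {A : Set} (p : A → Bool) (xs : List A) → (∀ x → p x ≡ true) → filterᵇ p xs ≡ xs
filterᵇ-all p []       p≡true = refl
filterᵇ-all p (x ∷ xs) p≡true = trans (filterᵇ-accept p xs (p≡true x)) (cong (x ∷_) (filterᵇ-all p xs p≡true))

filterᵇ-none : {A : Set} (p : A → Bool) (xs : List A) → (∀ x → p x ≡ false) → filterᵇ p xs ≡ []
filterᵇ-none p []       p≡false = refl
filterᵇ-none p (x ∷ xs) p≡false = trans (filterᵇ-reject p xs (p≡false x)) (filterᵇ-none p xs p≡false)

filterᵇ-filterᵇ : {A : Set} (p q : A → Bool) (xs : List A) → filterᵇ p (filterᵇ q xs) ≡ filterᵇ (λ x → q x ∧ p x) xs
filterᵇ-filterᵇ p q []       = refl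
filterᵇ-filterᵇ p q (x ∷ xs) with q x
... | false = filterᵇ-filterᵇ p q xs
... | true with p x
...   | true  = cong (x ∷_) (filterᵇ-filterᵇ p q xs)
...   | false = filterᵇ-filterᵇ p q xs

filterᵇ-cong : {A : Set} {p q : A → Bool} → (∀ x → p x ≡ q x) → (xs : List A) → filterᵇ p xs ≡ filterᵇ q xs
filterᵇ-cong p≗q []       = refl
filterᵇ-cong {p = p} {q} p≗q (x ∷ xs) with p x | q x | p≗q x
... | true  | true  | refl = cong (x ∷_) (filterᵇ-cong p≗q xs)
... | false | false | refl = filterᵇ-cong p≗q xs

anyᵇ : {A : Set} → (A → Bool) → List A → Bool
anyᵇ p = foldr (λ x b → p x ∨ b) false

anyᵇ-true : {A : Set} {p : A → Bool} {x : A} {xs : List A} → x ∈ xs → p x ≡ true → anyᵇ p xs ≡ true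
anyᵇ-true {p = p} {xs = _ ∷ ys} (here refl) px = cong (_∨ anyᵇ p ys) px
anyᵇ-true {p = p} {xs = y ∷ _}  (there x∈xs) px = trans (cong (p y ∨_) (anyᵇ-true x∈xs px)) (∨-zeroʳ (p y))

anyᵇ-witness : {A : Set} (p : A → Bool) (xs : List A) → anyᵇ p xs ≡ true → ∃[ x ] p x ≡ true
anyᵇ-witness p (x ∷ xs) any≡true with p x in px
... | true  = x , px
... | false = anyᵇ-witness p xs any≡true

anyᵇ-false : {A : Set} (p : A → Bool) (xs : List A) → (∀ x → p x ≡ false) → anyᵇ p xs ≡ false
anyᵇ-false p []       p≡false = refl
anyᵇ-false p (x ∷ xs) p≡false = cong₂ _∨_ (p≡false x) (anyᵇ-false p xs p≡false)

anyᵇ-false⁻ : {A : Set} (p : A → Bool) {x : A} {xs : List A} → anyᵇ p xs ≡ false → x ∈ xs → p x ≡ false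
anyᵇ-false⁻ p {x} any≡false x∈xs with p x in px
... | false = refl
... | true with () ← trans (sym (anyᵇ-true x∈xs px)) any≡false

anyᵇ-cong : {A : Set} {p q : A → Bool} → (∀ x → p x ≡ q x) → (xs : List A) → anyᵇ p xs ≡ anyᵇ q xs
anyᵇ-cong p≗q []       = refl
anyᵇ-cong p≗q (x ∷ xs) = cong₂ _∨_ (p≗q x) (anyᵇ-cong p≗q xs)

all-∈ : {A : Set} (p : A → Bool) {x : A} {xs : List A} → all p xs ≡ true → x ∈ xs → p x ≡ true
all-∈ p {xs = y ∷ ys} all≡true x∈ with p y in py
all-∈ p {xs = y ∷ ys} all≡true (here refl) | true = py
all-∈ p {xs = y ∷ ys} all≡true (there x∈) | true = all-∈ p all≡true x∈

all-filterᵇ : {A : Set} (p q : A → Bool) (xs : List A) → all p xs ≡ true → all p (filterᵇ q xs) ≡ true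
all-filterᵇ p q []       all≡true = refl
all-filterᵇ p q (x ∷ xs) all≡true with p x in px | q x
... | true | true  = trans (cong (_∧ all p (filterᵇ q xs)) px) (all-filterᵇ p q xs all≡true)
... | true | false = all-filterᵇ p q xs all≡true

all-false : {A : Set} (p : A → Bool) (xs : List A) → all p xs ≡ false → ∃[ x ] x ∈ xs × p x ≡ false
all-false p (x ∷ xs) all≡false with p x in px
... | false = x , here refl , px
... | true with y , y∈xs , py ← all-false p xs all≡false = y , there y∈xs , py

sumOver-subsets-∷ : {A : Set} (f : List A → ℚ) (x : A) (xs : List A) →
  sumOver f (subsets (x ∷ xs)) ≡ sumOver (f ∘ (x ∷_)) (subsets xs) + sumOver f (subsets xs)
sumOver-subsets-∷ f x xs =
  trans (sumOver-++ f (map (x ∷_) (subsets xs)) (subsets xs))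
        (cong (_+ sumOver f (subsets xs)) (sumOver-map f (x ∷_) (subsets xs)))

sumOver-subsets-all : {A : Set} (p : A → Bool) (φ : List A → ℚ) (xs : List A) →
  sumOver (λ E → if all p E then φ E else 0ℚ) (subsets xs) ≡ sumOver φ (subsets (filterᵇ p xs))
sumOver-subsets-all p φ []       = refl
sumOver-subsets-all p φ (x ∷ xs) with p x in px
... | true  = begin
    sumOver ψ (subsets (x ∷ xs))
  ≡⟨ sumOver-subsets-∷ ψ x xs ⟩
    sumOver (ψ ∘ (x ∷_)) (subsets xs) + sumOver ψ (subsets xs)
  ≡⟨ cong (_+ sumOver ψ (subsets xs)) (sumOver-cong (λ E → cong (λ b → if b ∧ all p E then φ (x ∷ E) else 0ℚ) px) (subsets xs)) ⟩
    sumOver (λ E → if all p E then φ (x ∷ E) else 0ℚ) (subsets xs) + sumOver ψ (subsets xs)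
  ≡⟨ cong₂ _+_ (sumOver-subsets-all p (φ ∘ (x ∷_)) xs) (sumOver-subsets-all p φ xs) ⟩
    sumOver (φ ∘ (x ∷_)) (subsets (filterᵇ p xs)) + sumOver φ (subsets (filterᵇ p xs))
  ≡⟨ sym (sumOver-subsets-∷ φ x (filterᵇ p xs)) ⟩
    sumOver φ (subsets (x ∷ filterᵇ p xs)) ∎
  where
  open ≡-Reasoning
  ψ : List _ → ℚ
  ψ E = if all p E then φ E else 0ℚ
... | false = begin
    sumOver ψ (subsets (x ∷ xs))
  ≡⟨ sumOver-subsets-∷ ψ x xs ⟩
    sumOver (ψ ∘ (x ∷_)) (subsets xs) + sumOver ψ (subsets xs)
  ≡⟨ cong₂ _+_ (trans (sumOver-cong (λ E → cong (λ b → if b ∧ all p E then φ (x ∷ E) else 0ℚ) px) (subsets xs)) (sumOver-0 (subsets xs)))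
               (sumOver-subsets-all p φ xs) ⟩
    0ℚ + sumOver φ (subsets (filterᵇ p xs))
  ≡⟨ ℚ.+-identityˡ _ ⟩
    sumOver φ (subsets (filterᵇ p xs)) ∎
  where
  open ≡-Reasoning
  ψ : List _ → ℚ
  ψ E = if all p E then φ E else 0ℚ

sumOver-subsets-factor : {A : Set} (c : A → Bool) (w : A → ℚ) (H : List A → ℚ) (xs : List A) →
  sumOver (λ E → prodOver w (filterᵇ c E) · H (filterᵇ (not ∘ c) E)) (subsets xs)
    ≡ prodOver (λ x → 1ℚ + w x) (filterᵇ c xs) · sumOver H (subsets (filterᵇ (not ∘ c) xs))
sumOver-subsets-factor c w H []       = trans (ℚ.+-identityʳ _) (cong (1ℚ ·_) (sym (ℚ.+-identityʳ (H []))))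
sumOver-subsets-factor c w H (x ∷ xs) with c x in cx
... | true  = begin
    sumOver (λ E → prodOver w (filterᵇ c E) · H (filterᵇ (not ∘ c) E)) (subsets (x ∷ xs))
  ≡⟨ sumOver-subsets-∷ _ x xs ⟩
    sumOver (λ E → prodOver w (filterᵇ c (x ∷ E)) · H (filterᵇ (not ∘ c) (x ∷ E))) (subsets xs) + R
  ≡⟨ cong (_+ R) (sumOver-cong (λ E → cong₂ (λ L M → prodOver w L · H M)
       (filterᵇ-accept c E cx) (filterᵇ-reject (not ∘ c) E (cong not cx))) (subsets xs)) ⟩
    sumOver (λ E → (w x · prodOver w (filterᵇ c E)) · H (filterᵇ (not ∘ c) E)) (subsets xs) + R
  ≡⟨ cong (_+ R) (trans (sumOver-cong (λ E → ℚ.*-assoc (w x) _ _) (subsets xs)) (sumOver-*ˡ (w x) _ (subsets xs))) ⟩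
    w x · sumOver (λ E → prodOver w (filterᵇ c E) · H (filterᵇ (not ∘ c) E)) (subsets xs) + R
  ≡⟨ cong (λ r → w x · r + r) (sumOver-subsets-factor c w H xs) ⟩
    w x · (P · Q) + P · Q
  ≡⟨ solve 3 (λ a p t → a :* (p :* t) :+ p :* t := ((con 1ℚ :+ a) :* p) :* t) refl (w x) P Q ⟩
    ((1ℚ + w x) · P) · Q ∎
  where
  open ≡-Reasoning
  R = sumOver (λ E → prodOver w (filterᵇ c E) · H (filterᵇ (not ∘ c) E)) (subsets xs)
  P = prodOver (λ x → 1ℚ + w x) (filterᵇ c xs)
  Q = sumOver H (subsets (filterᵇ (not ∘ c) xs))
... | false = begin
    sumOver (λ E → prodOver w (filterᵇ c E) · H (filterᵇ (not ∘ c) E)) (subsets (x ∷ xs))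
  ≡⟨ sumOver-subsets-∷ _ x xs ⟩
    sumOver (λ E → prodOver w (filterᵇ c (x ∷ E)) · H (filterᵇ (not ∘ c) (x ∷ E))) (subsets xs)
      + sumOver (λ E → prodOver w (filterᵇ c E) · H (filterᵇ (not ∘ c) E)) (subsets xs)
  ≡⟨ cong (_+ _) (sumOver-cong (λ E → cong₂ (λ L M → prodOver w L · H M)
       (filterᵇ-reject c E cx) (filterᵇ-accept (not ∘ c) E (cong not cx))) (subsets xs)) ⟩
    sumOver (λ E → prodOver w (filterᵇ c E) · H (x ∷ filterᵇ (not ∘ c) E)) (subsets xs)
      + sumOver (λ E → prodOver w (filterᵇ c E) · H (filterᵇ (not ∘ c) E)) (subsets xs)
  ≡⟨ cong₂ _+_ (sumOver-subsets-factor c w (H ∘ (x ∷_)) xs) (sumOver-subsets-factor c w H xs) ⟩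
    P · sumOver (H ∘ (x ∷_)) (subsets (filterᵇ (not ∘ c) xs)) + P · sumOver H (subsets (filterᵇ (not ∘ c) xs))
  ≡⟨ sym (ℚ.*-distribˡ-+ P _ _) ⟩
    P · (sumOver (H ∘ (x ∷_)) (subsets (filterᵇ (not ∘ c) xs)) + sumOver H (subsets (filterᵇ (not ∘ c) xs)))
  ≡⟨ cong (P ·_) (sym (sumOver-subsets-∷ H x (filterᵇ (not ∘ c) xs))) ⟩
    P · sumOver H (subsets (x ∷ filterᵇ (not ∘ c) xs)) ∎
  where
  open ≡-Reasoning
  P = prodOver (λ x → 1ℚ + w x) (filterᵇ c xs)

VertexSet : ℕ → Set
VertexSet = Vector Bool

vertexSets : (n : ℕ) → List (VertexSet n)
vertexSets zero    = []ᵛ ∷ []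
vertexSets (suc n) = map (true ∷ᵛ_) (vertexSets n) ++ map (false ∷ᵛ_) (vertexSets n)

_∩_ _∖_ : {n : ℕ} → VertexSet n → VertexSet n → VertexSet n
(S ∩ X) v = S v ∧ X v
(X ∖ S) v = X v ∧ not (S v)

size : {n : ℕ} → VertexSet n → ℕ
size {zero}  S = 0
size {suc n} S = (if head S then 1 else 0) ℕ.+ size (tail S)

sumOver-vertexSets-suc : {n : ℕ} (φ : VertexSet (suc n) → ℚ) →
  sumOver φ (vertexSets (suc n)) ≡ sumOver (φ ∘ (true ∷ᵛ_)) (vertexSets n) + sumOver (φ ∘ (false ∷ᵛ_)) (vertexSets n)
sumOver-vertexSets-suc {n} φ = trans (sumOver-++ φ (map (true ∷ᵛ_) (vertexSets n)) (map (false ∷ᵛ_) (vertexSets n)))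
  (cong₂ _+_ (sumOver-map φ (true ∷ᵛ_) (vertexSets n)) (sumOver-map φ (false ∷ᵛ_) (vertexSets n)))

sumOver-vertexSets-prodFin : (n : ℕ) (f : Fin n → Bool → ℚ) →
  sumOver (λ S → prodFin n (λ v → f v (S v))) (vertexSets n) ≡ prodFin n (λ v → f v true + f v false)
sumOver-vertexSets-prodFin zero    f = refl
sumOver-vertexSets-prodFin (suc n) f = begin
    sumOver (λ S → prodFin (suc n) (λ v → f v (S v))) (vertexSets (suc n))
  ≡⟨ sumOver-vertexSets-suc (λ S → prodFin (suc n) (λ v → f v (S v))) ⟩
    sumOver (λ S → f fz true · Π S) (vertexSets n) + sumOver (λ S → f fz false · Π S) (vertexSets n)
  ≡⟨ cong₂ _+_ (sumOver-*ˡ (f fz true) Π (vertexSets n)) (sumOver-*ˡ (f fz false) Π (vertexSets n)) ⟩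
    f fz true · sumOver Π (vertexSets n) + f fz false · sumOver Π (vertexSets n)
  ≡⟨ sym (ℚ.*-distribʳ-+ _ (f fz true) (f fz false)) ⟩
    (f fz true + f fz false) · sumOver Π (vertexSets n)
  ≡⟨ cong ((f fz true + f fz false) ·_) (sumOver-vertexSets-prodFin n (f ∘ fs)) ⟩
    prodFin (suc n) (λ v → f v true + f v false) ∎
  where
  open ≡-Reasoning
  Π : VertexSet n → ℚ
  Π S = prodFin n (λ v → f (fs v) (S v))

prodFin-size : {n : ℕ} (S : VertexSet n) (c : ℚ) → prodFin n (λ v → if S v then c else 1ℚ) ≡ pow c (size S)
prodFin-size {zero}  S c = refl
prodFin-size {suc n} S c with S fz
... | true  = cong (c ·_) (prodFin-size (tail S) c)
... | false = trans (ℚ.*-identityˡ _) (prodFin-size (tail S) c)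

memberSign : Bool → Bool → ℚ
memberSign x true  = if x then - 1ℚ else 0ℚ
memberSign x false = 1ℚ

-- (-1)^|S| when S ⊆ X, and 0 otherwise
subsetSign : {n : ℕ} → VertexSet n → VertexSet n → ℚ
subsetSign {n} X S = prodFin n (λ v → memberSign (X v) (S v))

sumOver-subsetSign : {n : ℕ} (X : VertexSet n) (v : Fin n) → X v ≡ true → sumOver (subsetSign X) (vertexSets n) ≡ 0ℚ
sumOver-subsetSign {n} X v Xv = trans (sumOver-vertexSets-prodFin n (λ v → memberSign (X v)))
  (prodFin-zero _ v (cong (λ b → memberSign b true + 1ℚ) Xv))

size-∩+size-∖ : {n : ℕ} (S X : VertexSet n) → size (S ∩ X) ℕ.+ size (X ∖ S) ≡ size X
size-∩+size-∖ {zero}  S X = refl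
size-∩+size-∖ {suc n} S X with X fz | S fz
... | true  | true  = cong suc (size-∩+size-∖ (tail S) (tail X))
... | true  | false = trans (ℕ.+-suc _ _) (cong suc (size-∩+size-∖ (tail S) (tail X)))
... | false | true  = size-∩+size-∖ (tail S) (tail X)
... | false | false = size-∩+size-∖ (tail S) (tail X)

size-∖-≤ : {n : ℕ} (X S : VertexSet n) → size (X ∖ S) ≤ size X
size-∖-≤ X S = ℕ.≤-trans (ℕ.m≤n+m (size (X ∖ S)) _) (ℕ.≤-reflexive (size-∩+size-∖ S X))

size-≤ : {n : ℕ} (X : VertexSet n) → size X ≤ n
size-≤ {zero}  X = ℕ.z≤n
size-≤ {suc n} X with X fz
... | true  = ℕ.s≤s (size-≤ (tail X))
... | false = ℕ.m≤n⇒m≤1+n (size-≤ (tail X))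

size-full : (n : ℕ) → size {n} (λ _ → true) ≡ n
size-full zero    = refl
size-full (suc n) = cong suc (size-full n)

size≡0 : {n : ℕ} (X : VertexSet n) → size X ≡ 0 → ∀ v → X v ≡ false
size≡0 {suc n} X empty v with X fz in Xfz
size≡0 {suc n} X empty fz     | false = Xfz
size≡0 {suc n} X empty (fs v) | false = size≡0 (tail X) empty v

size≡suc : {n : ℕ} (X : VertexSet n) {k : ℕ} → size X ≡ suc k → ∃[ v ] X v ≡ true
size≡suc {suc n} X nonempty with X fz in Xfz
... | true  = fz , Xfz
... | false with v , Xv ← size≡suc (tail X) nonempty = fs v , Xv

∖-size : {n : ℕ} (X S : VertexSet n) → size (X ∖ S) ≡ size X → ∀ v → (X ∖ S) v ≡ X v
∖-size X S same v with X v in Xv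
... | false = refl
... | true  = cong not (trans (sym (∧-identityʳ (S v))) (trans (cong (S v ∧_) (sym Xv)) (size≡0 (S ∩ X) disjoint v)))
  where
  disjoint : size (S ∩ X) ≡ 0
  disjoint = ℕ.+-cancelʳ-≡ (size (X ∖ S)) _ 0 (trans (size-∩+size-∖ S X) (sym same))

-- Walks, cycles and sources

hasEdge-∈ : {n : ℕ} (D : List (Edge n)) {s t : Fin n} → hasEdge D s t ≡ true → (s , t) ∈ D
hasEdge-∈ ((a , b) ∷ D) {s} {t} h with a ≟ᶠ s | b ≟ᶠ t
... | yes refl | yes refl = here refl
... | yes refl | no _     = there (hasEdge-∈ D h)
... | no _     | _        = there (hasEdge-∈ D h)

∈-hasEdge : {n : ℕ} {D : List (Edge n)} {s t : Fin n} → (s , t) ∈ D → hasEdge D s t ≡ true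
∈-hasEdge {s = s} {t} (here refl) with s ≟ᶠ s | t ≟ᶠ t
... | yes _  | yes _  = refl
... | no s≢s | _      = contradiction refl s≢s
... | yes _  | no t≢t = contradiction refl t≢t
∈-hasEdge {D = (a , b) ∷ _} {s} {t} (there st∈D) =
  trans (cong (⌊ a ≟ᶠ s ⌋ ∧ ⌊ b ≟ᶠ t ⌋ ∨_) (∈-hasEdge st∈D)) (∨-zeroʳ _)

module _ {n : ℕ} where

  endsIn : VertexSet n → Edge n → Bool
  endsIn S e = S (proj₂ e)

  leaves : VertexSet n → Edge n → Bool
  leaves S e = S (proj₁ e) ∧ not (S (proj₂ e))

  within : VertexSet n → Edge n → Bool
  within X e = X (proj₁ e) ∧ X (proj₂ e)

  sources : VertexSet n → List (Edge n) → VertexSet n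
  sources X D v = X v ∧ not (anyFin n (λ s → hasEdge D s v))

  hasEdge-into : (S : VertexSet n) (D : List (Edge n)) → all (not ∘ endsIn S) D ≡ true →
    (s t : Fin n) → S t ≡ true → hasEdge D s t ≡ false
  hasEdge-into S D noneInto s t St with hasEdge D s t in h
  ... | false = refl
  ... | true  with () ← trans (sym (cong not St)) (all-∈ (not ∘ endsIn S) noneInto (hasEdge-∈ D h))

  walk-into : (S : VertexSet n) (D : List (Edge n)) → all (not ∘ endsIn S) D ≡ true →
    (k : ℕ) (s t : Fin n) → S t ≡ true → walk D k s t ≡ false
  walk-into S D noneInto zero    s t St = hasEdge-into S D noneInto s t St
  walk-into S D noneInto (suc k) s t St = anyᵇ-false _ (allFin n)
    (λ v → trans (cong (hasEdge D s v ∧_) (walk-into S D noneInto k v t St)) (∧-zeroʳ _))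

  hasEdge-dropLeaving : (S : VertexSet n) (D : List (Edge n)) (s t : Fin n) → S s ≡ false →
    hasEdge D s t ≡ hasEdge (filterᵇ (not ∘ leaves S) D) s t
  hasEdge-dropLeaving S []            s t Ss = refl
  hasEdge-dropLeaving S ((a , b) ∷ D) s t Ss with S a in Sa | S b
  ... | false | _     = cong (⌊ a ≟ᶠ s ⌋ ∧ ⌊ b ≟ᶠ t ⌋ ∨_) (hasEdge-dropLeaving S D s t Ss)
  ... | true  | true  = cong (⌊ a ≟ᶠ s ⌋ ∧ ⌊ b ≟ᶠ t ⌋ ∨_) (hasEdge-dropLeaving S D s t Ss)
  ... | true  | false with a ≟ᶠ s
  ...   | yes refl with () ← trans (sym Sa) Ss
  ...   | no _     = hasEdge-dropLeaving S D s t Ss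

  -- Vertices of S have no incoming edges, so they lie on no walk except as its start.
  walk-dropLeaving : (S : VertexSet n) (D : List (Edge n)) → all (not ∘ endsIn S) D ≡ true →
    (k : ℕ) (s t : Fin n) → S s ≡ false → walk D k s t ≡ walk (filterᵇ (not ∘ leaves S) D) k s t
  walk-dropLeaving S D noneInto zero    s t Ss = hasEdge-dropLeaving S D s t Ss
  walk-dropLeaving S D noneInto (suc k) s t Ss = anyᵇ-cong step (allFin n)
    where
    D′ = filterᵇ (not ∘ leaves S) D
    step : (v : Fin n) → (hasEdge D s v ∧ walk D k v t) ≡ (hasEdge D′ s v ∧ walk D′ k v t)
    step v with S v in Sv
    ... | false = cong₂ _∧_ (hasEdge-dropLeaving S D s v Ss) (walk-dropLeaving S D noneInto k v t Sv)
    ... | true  = trans (cong (_∧ walk D k v t) (hasEdge-into S D noneInto s v Sv))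
                    (sym (cong (_∧ walk D′ k v t) (hasEdge-into S D′ (all-filterᵇ _ _ D noneInto) s v Sv)))

  acyclic-dropLeaving : (S : VertexSet n) (D : List (Edge n)) → all (not ∘ endsIn S) D ≡ true →
    acyclic D ≡ acyclic (filterᵇ (not ∘ leaves S) D)
  acyclic-dropLeaving S D noneInto = cong not (anyᵇ-cong closedAt (allFin n))
    where
    D′ = filterᵇ (not ∘ leaves S) D
    closedAt : (s : Fin n) → anyᵇ (λ k → walk D k s s) (upTo n) ≡ anyᵇ (λ k → walk D′ k s s) (upTo n)
    closedAt s with S s in Ss
    ... | false = anyᵇ-cong (λ k → walk-dropLeaving S D noneInto k s s Ss) (upTo n)
    ... | true  = anyᵇ-cong (λ k → trans (walk-into S D noneInto k s s Ss)
                    (sym (walk-into S D′ (all-filterᵇ _ _ D noneInto) k s s Ss))) (upTo n)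

  acyclic-[] : acyclic {n} [] ≡ true
  acyclic-[] = cong not (anyᵇ-false _ (allFin n) (λ s → anyᵇ-false _ (upTo n)
    (λ k → walk-into (λ _ → true) [] refl k s s refl)))

  closedWalk-acyclic : (D : List (Edge n)) (k : ℕ) (s : Fin n) → walk D k s s ≡ true → k < n → acyclic D ≡ false
  closedWalk-acyclic D k s closed k<n = cong not (anyᵇ-true (∈-allFin s) (anyᵇ-true (∈-upTo⁺ k<n) closed))

  -- Without sources, every vertex of X has a predecessor in X; following predecessors
  -- n + 1 times repeats a vertex, which closes a walk of length at most n.
  module _ (X : VertexSet n) (D : List (Edge n)) (D⊆X : all (within X) D ≡ true)
           (sourceless : ∀ v → sources X D v ≡ false) where

    private
      Member = Σ (Fin n) (λ v → X v ≡ true)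

      predecessor : (v : Member) → Σ Member (λ u → hasEdge D (proj₁ u) (proj₁ v) ≡ true)
      predecessor (v , Xv) with anyFin n (λ s → hasEdge D s v) in incoming | sourceless v
      ... | true | _ with u , uv ← anyᵇ-witness (λ s → hasEdge D s v) (allFin n) incoming =
            (u , ∧-true-left (all-∈ (within X) D⊆X (hasEdge-∈ D uv))) , uv
        where
        ∧-true-left : ∀ {b c} → b ∧ c ≡ true → b ≡ true
        ∧-true-left {true} _ = refl
      ... | false | notSource with () ← trans (sym (cong (_∧ true) Xv)) notSource

      ancestor : Member → ℕ → Member
      ancestor v zero    = v
      ancestor v (suc k) = proj₁ (predecessor (ancestor v k))

      walk-ancestor : (v : Member) (d k : ℕ) → walk D d (proj₁ (ancestor v (suc (d ℕ.+ k)))) (proj₁ (ancestor v k)) ≡ true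
      walk-ancestor v zero    k = proj₂ (predecessor (ancestor v k))
      walk-ancestor v (suc d) k = anyᵇ-true (∈-allFin (proj₁ (ancestor v (suc (d ℕ.+ k)))))
        (cong₂ _∧_ (proj₂ (predecessor (ancestor v (suc (d ℕ.+ k))))) (walk-ancestor v d k))

    sourceless-cyclic : Member → acyclic D ≡ false
    sourceless-cyclic v with i , j , i<j , same ← pigeonhole (ℕ.n<1+n n) (λ (i : Fin (suc n)) → proj₁ (ancestor v (toℕ i))) =
      closedWalk-acyclic D d (proj₁ (ancestor v (toℕ i))) closed d<n
      where
      d = toℕ j ∸ suc (toℕ i)
      j≡ : suc (d ℕ.+ toℕ i) ≡ toℕ j
      j≡ = trans (sym (ℕ.+-suc d (toℕ i))) (ℕ.m∸n+n≡m i<j)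
      d<n : d < n
      d<n = ℕ.<-≤-trans (subst (d <_) j≡ (ℕ.s≤s (ℕ.m≤m+n d (toℕ i)))) (ℕ.≤-pred (toℕ<n j))
      closed : walk D d (proj₁ (ancestor v (toℕ i))) (proj₁ (ancestor v (toℕ i))) ≡ true
      closed = subst (λ a → walk D d a (proj₁ (ancestor v (toℕ i))) ≡ true)
                 (trans (cong (proj₁ ∘ ancestor v) j≡) (sym same)) (walk-ancestor v d (toℕ i))

  acyclic-source : (X : VertexSet n) (D : List (Edge n)) → all (within X) D ≡ true → acyclic D ≡ true →
    (v : Fin n) → X v ≡ true → ∃[ s ] sources X D s ≡ true
  acyclic-source X D D⊆X acyc v Xv with anyFin n (sources X D) in someSource
  ... | true  = anyᵇ-witness (sources X D) (allFin n) someSource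
  ... | false with () ← trans (sym acyc) (sourceless-cyclic X D D⊆X
                          (λ s → anyᵇ-false⁻ (sources X D) someSource (∈-allFin s)) (v , Xv))

-- The source expansion

module _ {n : ℕ} (u y : ℚ) where

  edgeWeight : Edge n → ℚ
  edgeWeight (s , t) = if does (toℕ t ℕ.<? toℕ s) then u · y else y

  digraphWeight : List (Edge n) → ℚ
  digraphWeight D = if acyclic D then pow u (des D) · pow y (e D) else 0ℚ

  edgesWithin : VertexSet n → List (Edge n)
  edgesWithin X = filterᵇ (within X) (allEdges n)

  aOn : VertexSet n → ℚ
  aOn X = sumOver digraphWeight (subsets (edgesWithin X))

  cutWeight : VertexSet n → VertexSet n → ℚ
  cutWeight X S = prodOver (λ e → 1ℚ + edgeWeight e) (filterᵇ (leaves S) (edgesWithin X))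

  monomial≡prodOver : (D : List (Edge n)) → pow u (des D) · pow y (e D) ≡ prodOver edgeWeight D
  monomial≡prodOver = pow·pow≡prodOver (λ st → toℕ (proj₂ st) ℕ.<? toℕ (proj₁ st)) u y

  digraphWeight-split : (S : VertexSet n) (D : List (Edge n)) → all (not ∘ endsIn S) D ≡ true →
    digraphWeight D ≡ prodOver edgeWeight (filterᵇ (leaves S) D) · digraphWeight (filterᵇ (not ∘ leaves S) D)
  digraphWeight-split S D noneInto with acyclic D | acyclic-dropLeaving S D noneInto
  ... | true  | acyclic′ = begin
      pow u (des D) · pow y (e D)
    ≡⟨ monomial≡prodOver D ⟩
      prodOver edgeWeight D
    ≡⟨ prodOver-partition edgeWeight (leaves S) D ⟩
      P · prodOver edgeWeight D′
    ≡⟨ cong (P ·_) (sym (monomial≡prodOver D′)) ⟩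
      P · (pow u (des D′) · pow y (e D′))
    ≡⟨ cong (λ b → P · (if b then pow u (des D′) · pow y (e D′) else 0ℚ)) acyclic′ ⟩
      P · digraphWeight D′ ∎
    where
    open ≡-Reasoning
    P = prodOver edgeWeight (filterᵇ (leaves S) D)
    D′ = filterᵇ (not ∘ leaves S) D
  ... | false | acyclic′ = trans (sym (ℚ.*-zeroʳ P))
    (cong (λ b → P · (if b then pow u (des D′) · pow y (e D′) else 0ℚ)) acyclic′)
    where
    P = prodOver edgeWeight (filterᵇ (leaves S) D)
    D′ = filterᵇ (not ∘ leaves S) D

  subsetSign-sources : (X S : VertexSet n) (D : List (Edge n)) → all (not ∘ endsIn S) D ≡ true →
    subsetSign (sources X D) S ≡ subsetSign X S
  subsetSign-sources X S D noneInto = prodFin-cong sign≡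
    where
    sign≡ : ∀ v → memberSign (sources X D v) (S v) ≡ memberSign (X v) (S v)
    sign≡ v with S v in Sv
    ... | false = refl
    ... | true  = cong (λ b → memberSign b true)
                    (trans (cong (λ b → X v ∧ not b) (anyᵇ-false _ (allFin n) (λ s → hasEdge-into S D noneInto s v Sv)))
                           (∧-identityʳ (X v)))

  subsetSign-sources-into : (X S : VertexSet n) (D : List (Edge n)) → all (not ∘ endsIn S) D ≡ false →
    subsetSign (sources X D) S ≡ 0ℚ
  subsetSign-sources-into X S D someInto with (s , t) , st∈D , intoS ← all-false (not ∘ endsIn S) D someInto =
    prodFin-zero _ t (cong₂ memberSign notSource (not-injective intoS))
    where
    notSource : sources X D t ≡ false
    notSource = trans (cong (λ b → X t ∧ not b) (anyᵇ-true (∈-allFin s) (∈-hasEdge st∈D))) (∧-zeroʳ (X t))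

  digraphWeight-subsetSign : (X S : VertexSet n) (D : List (Edge n)) →
    digraphWeight D · subsetSign (sources X D) S
      ≡ subsetSign X S · (if all (not ∘ endsIn S) D
                          then prodOver edgeWeight (filterᵇ (leaves S) D) · digraphWeight (filterᵇ (not ∘ leaves S) D)
                          else 0ℚ)
  digraphWeight-subsetSign X S D with all (not ∘ endsIn S) D in noneInto
  ... | true  = trans (cong₂ _·_ (digraphWeight-split S D noneInto) (subsetSign-sources X S D noneInto))
                      (ℚ.*-comm (prodOver edgeWeight (filterᵇ (leaves S) D) · digraphWeight (filterᵇ (not ∘ leaves S) D)) (subsetSign X S))
  ... | false = trans (cong (digraphWeight D ·_) (subsetSign-sources-into X S D noneInto))
                      (trans (ℚ.*-zeroʳ (digraphWeight D)) (sym (ℚ.*-zeroʳ (subsetSign X S))))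

  -- An acyclic digraph on a nonempty X has a source, so the signs of the sets of its sources cancel.
  digraphWeight-sumOver-subsetSign : (X : VertexSet n) (v : Fin n) → X v ≡ true → (D : List (Edge n)) →
    all (within X) D ≡ true → digraphWeight D · sumOver (subsetSign (sources X D)) (vertexSets n) ≡ 0ℚ
  digraphWeight-sumOver-subsetSign X v Xv D D⊆X with acyclic D in acyc
  ... | false = ℚ.*-zeroˡ (sumOver (subsetSign (sources X D)) (vertexSets n))
  ... | true with s , source ← acyclic-source X D D⊆X acyc v Xv =
    trans (cong (pow u (des D) · pow y (e D) ·_) (sumOver-subsetSign (sources X D) s source))
          (ℚ.*-zeroʳ (pow u (des D) · pow y (e D)))

  edgesWithin-leaving : (X S : VertexSet n) →
    filterᵇ (leaves S) (filterᵇ (not ∘ endsIn S) (edgesWithin X)) ≡ filterᵇ (leaves S) (edgesWithin X)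
  edgesWithin-leaving X S = trans (filterᵇ-filterᵇ (leaves S) (not ∘ endsIn S) (edgesWithin X))
    (filterᵇ-cong (λ e → notInto∧leaving (S (proj₁ e)) (S (proj₂ e))) (edgesWithin X))
    where
    notInto∧leaving : ∀ s t → not t ∧ (s ∧ not t) ≡ s ∧ not t
    notInto∧leaving s     false = refl
    notInto∧leaving true  true  = refl
    notInto∧leaving false true  = refl

  edgesWithin-∖ : (X S : VertexSet n) →
    filterᵇ (not ∘ leaves S) (filterᵇ (not ∘ endsIn S) (edgesWithin X)) ≡ edgesWithin (X ∖ S)
  edgesWithin-∖ X S = begin
      filterᵇ (not ∘ leaves S) (filterᵇ (not ∘ endsIn S) (filterᵇ (within X) (allEdges n)))
    ≡⟨ cong (filterᵇ (not ∘ leaves S)) (filterᵇ-filterᵇ (not ∘ endsIn S) (within X) (allEdges n)) ⟩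
      filterᵇ (not ∘ leaves S) (filterᵇ (λ e → within X e ∧ not (endsIn S e)) (allEdges n))
    ≡⟨ filterᵇ-filterᵇ (not ∘ leaves S) _ (allEdges n) ⟩
      filterᵇ (λ e → (within X e ∧ not (endsIn S e)) ∧ not (leaves S e)) (allEdges n)
    ≡⟨ filterᵇ-cong (λ e → within∖ (X (proj₁ e)) (X (proj₂ e)) (S (proj₁ e)) (S (proj₂ e))) (allEdges n) ⟩
      edgesWithin (X ∖ S) ∎
    where
    open ≡-Reasoning
    within∖ : ∀ xs xt ss st → ((xs ∧ xt) ∧ not st) ∧ not (ss ∧ not st) ≡ (xs ∧ not ss) ∧ (xt ∧ not st)
    within∖ false _     _     _     = refl
    within∖ true  false true  _     = refl
    within∖ true  false false _     = refl
    within∖ true  true  true  true  = refl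
    within∖ true  true  true  false = refl
    within∖ true  true  false true  = refl
    within∖ true  true  false false = refl

  sumOver-noneInto : (X S : VertexSet n) →
    sumOver (λ D → if all (not ∘ endsIn S) D
                   then prodOver edgeWeight (filterᵇ (leaves S) D) · digraphWeight (filterᵇ (not ∘ leaves S) D)
                   else 0ℚ) (subsets (edgesWithin X))
      ≡ cutWeight X S · aOn (X ∖ S)
  sumOver-noneInto X S = begin
      _
    ≡⟨ sumOver-subsets-all (not ∘ endsIn S) _ (edgesWithin X) ⟩
      sumOver (λ D → prodOver edgeWeight (filterᵇ (leaves S) D) · digraphWeight (filterᵇ (not ∘ leaves S) D))
              (subsets (filterᵇ (not ∘ endsIn S) (edgesWithin X)))
    ≡⟨ sumOver-subsets-factor (leaves S) edgeWeight digraphWeight (filterᵇ (not ∘ endsIn S) (edgesWithin X)) ⟩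
      prodOver (λ e → 1ℚ + edgeWeight e) (filterᵇ (leaves S) (filterᵇ (not ∘ endsIn S) (edgesWithin X)))
        · sumOver digraphWeight (subsets (filterᵇ (not ∘ leaves S) (filterᵇ (not ∘ endsIn S) (edgesWithin X))))
    ≡⟨ cong₂ (λ L M → prodOver (λ e → 1ℚ + edgeWeight e) L · sumOver digraphWeight (subsets M))
         (edgesWithin-leaving X S) (edgesWithin-∖ X S) ⟩
      cutWeight X S · aOn (X ∖ S) ∎
    where open ≡-Reasoning

  sourceExpansion : (X : VertexSet n) (v : Fin n) → X v ≡ true →
    sumOver (λ S → subsetSign X S · (cutWeight X S · aOn (X ∖ S))) (vertexSets n) ≡ 0ℚ
  sourceExpansion X v Xv = sym (begin
      0ℚ
    ≡⟨ sym (sumOver-0 (subsets (allEdges n))) ⟩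
      sumOver (λ _ → 0ℚ) (subsets (allEdges n))
    ≡⟨ sumOver-cong vanishes (subsets (allEdges n)) ⟩
      sumOver (λ D → if all (within X) D then digraphWeight D · signs D else 0ℚ) (subsets (allEdges n))
    ≡⟨ sumOver-subsets-all (within X) _ (allEdges n) ⟩
      sumOver (λ D → digraphWeight D · signs D) (subsets (edgesWithin X))
    ≡⟨ sumOver-cong (λ D → sym (sumOver-*ˡ (digraphWeight D) _ (vertexSets n))) (subsets (edgesWithin X)) ⟩
      sumOver (λ D → sumOver (λ S → digraphWeight D · subsetSign (sources X D) S) (vertexSets n)) (subsets (edgesWithin X))
    ≡⟨ sumOver-comm (λ D S → digraphWeight D · subsetSign (sources X D) S) (subsets (edgesWithin X)) (vertexSets n) ⟩
      sumOver (λ S → sumOver (λ D → digraphWeight D · subsetSign (sources X D) S) (subsets (edgesWithin X))) (vertexSets n)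
    ≡⟨ sumOver-cong (λ S → trans (sumOver-cong (digraphWeight-subsetSign X S) (subsets (edgesWithin X)))
                                 (trans (sumOver-*ˡ (subsetSign X S) _ (subsets (edgesWithin X)))
                                        (cong (subsetSign X S ·_) (sumOver-noneInto X S)))) (vertexSets n) ⟩
      sumOver (λ S → subsetSign X S · (cutWeight X S · aOn (X ∖ S))) (vertexSets n) ∎)
    where
    open ≡-Reasoning
    signs : List (Edge n) → ℚ
    signs D = sumOver (subsetSign (sources X D)) (vertexSets n)
    vanishes : ∀ D → 0ℚ ≡ (if all (within X) D then digraphWeight D · signs D else 0ℚ)
    vanishes D with all (within X) D in D⊆X
    ... | true  = sym (digraphWeight-sumOver-subsetSign X v Xv D D⊆X)
    ... | false = refl

-- Layers of the expansion

module _ (u y : ℚ) where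

  cutFactor : {n : ℕ} → VertexSet n → VertexSet n → Fin n → Fin n → ℚ
  cutFactor X S s t = if within X (s , t) then (if leaves S (s , t) then 1ℚ + edgeWeight u y (s , t) else 1ℚ) else 1ℚ

  cutProduct : {n : ℕ} → VertexSet n → VertexSet n → ℚ
  cutProduct {n} X S = prodFin n (λ s → prodFin n (cutFactor X S s))

  cutFactor-diagonal : {n : ℕ} (X S : VertexSet n) (s : Fin n) → cutFactor X S s s ≡ 1ℚ
  cutFactor-diagonal X S s with X s | S s
  ... | false | _     = refl
  ... | true  | true  = refl
  ... | true  | false = refl

  cutWeight≡cutProduct : {n : ℕ} (X S : VertexSet n) → cutWeight u y X S ≡ cutProduct X S
  cutWeight≡cutProduct {n} X S = begin
      prodOver (λ e → 1ℚ + edgeWeight u y e) (filterᵇ (leaves S) (filterᵇ (within X) (allEdges n)))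
    ≡⟨ prodOver-filterᵇ (leaves S) (λ e → 1ℚ + edgeWeight u y e) (filterᵇ (within X) (allEdges n)) ⟩
      prodOver (λ e → if leaves S e then 1ℚ + edgeWeight u y e else 1ℚ) (filterᵇ (within X) (allEdges n))
    ≡⟨ prodOver-filterᵇ (within X) (λ e → if leaves S e then 1ℚ + edgeWeight u y e else 1ℚ) (allEdges n) ⟩
      prodOver (λ e → cutFactor X S (proj₁ e) (proj₂ e)) (allEdges n)
    ≡⟨ prodOver-concatMap (λ e → cutFactor X S (proj₁ e) (proj₂ e)) (λ s → map (s ,_) (filter (λ t → ¬? (s ≟ᶠ t)) (allFin n))) (allFin n) ⟩
      prodOver (λ s → prodOver (λ e → cutFactor X S (proj₁ e) (proj₂ e)) (map (s ,_) (filter (λ t → ¬? (s ≟ᶠ t)) (allFin n)))) (allFin n)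
    ≡⟨ prodOver-cong row (allFin n) ⟩
      prodOver (λ s → prodFin n (cutFactor X S s)) (allFin n)
    ≡⟨ prodOver-tabulate (λ s → prodFin n (cutFactor X S s)) (λ s → s) ⟩
      cutProduct X S ∎
    where
    open ≡-Reasoning
    offDiagonal : (s t : Fin n) → (if does (¬? (s ≟ᶠ t)) then cutFactor X S s t else 1ℚ) ≡ cutFactor X S s t
    offDiagonal s t with s ≟ᶠ t
    ... | yes refl = sym (cutFactor-diagonal X S s)
    ... | no _     = refl
    row : (s : Fin n) → prodOver (λ e → cutFactor X S (proj₁ e) (proj₂ e)) (map (s ,_) (filter (λ t → ¬? (s ≟ᶠ t)) (allFin n)))
                        ≡ prodFin n (cutFactor X S s)
    row s = begin
        _
      ≡⟨ prodOver-map (λ e → cutFactor X S (proj₁ e) (proj₂ e)) (s ,_) (filter (λ t → ¬? (s ≟ᶠ t)) (allFin n)) ⟩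
        prodOver (cutFactor X S s) (filter (λ t → ¬? (s ≟ᶠ t)) (allFin n))
      ≡⟨ prodOver-filter (λ t → ¬? (s ≟ᶠ t)) (cutFactor X S s) (allFin n) ⟩
        prodOver (λ t → if does (¬? (s ≟ᶠ t)) then cutFactor X S s t else 1ℚ) (allFin n)
      ≡⟨ prodOver-cong (offDiagonal s) (allFin n) ⟩
        prodOver (cutFactor X S s) (allFin n)
      ≡⟨ prodOver-tabulate (cutFactor X S s) (λ t → t) ⟩
        prodFin n (cutFactor X S s) ∎

  firstRow firstColumn : {n : ℕ} → VertexSet (suc n) → VertexSet (suc n) → ℚ
  firstRow    {n} X S = prodFin n (λ t → cutFactor X S fz (fs t))
  firstColumn {n} X S = prodFin n (λ s → cutFactor X S (fs s) fz)

  cutProduct-suc : {n : ℕ} (X S : VertexSet (suc n)) →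
    cutProduct X S ≡ (firstRow X S · firstColumn X S) · cutProduct (tail X) (tail S)
  cutProduct-suc {n} X S = begin
      (cutFactor X S fz fz · firstRow X S) · prodFin n (λ s → cutFactor X S (fs s) fz · prodFin n (cutFactor X S (fs s) ∘ fs))
    ≡⟨ cong₂ (λ d r → (d · firstRow X S) · r) (cutFactor-diagonal X S fz)
         (prodFin-· (λ s → cutFactor X S (fs s) fz) (λ s → prodFin n (cutFactor X S (fs s) ∘ fs))) ⟩
      (1ℚ · firstRow X S) · (firstColumn X S · cutProduct (tail X) (tail S))
    ≡⟨ solve 3 (λ r c p → (con 1ℚ :* r) :* (c :* p) := (r :* c) :* p) refl (firstRow X S) (firstColumn X S) _ ⟩
      (firstRow X S · firstColumn X S) · cutProduct (tail X) (tail S) ∎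
    where open ≡-Reasoning

  firstRow-in : {n : ℕ} (X : VertexSet (suc n)) (S : VertexSet n) → X fz ≡ true →
    firstRow X (true ∷ᵛ S) ≡ pow (1ℚ + y) (size (tail X ∖ S))
  firstRow-in X S Xfz = trans (prodFin-cong factor) (prodFin-size (tail X ∖ S) (1ℚ + y))
    where
    factor : ∀ t → cutFactor X (true ∷ᵛ S) fz (fs t) ≡ (if (tail X ∖ S) t then 1ℚ + y else 1ℚ)
    factor t rewrite Xfz with X (fs t) | S t
    ... | true  | true  = refl
    ... | true  | false = refl
    ... | false | _     = refl

  firstColumn-in : {n : ℕ} (X : VertexSet (suc n)) (S : VertexSet n) → firstColumn X (true ∷ᵛ S) ≡ 1ℚ
  firstColumn-in X S = prodFin-one factor
    where
    factor : ∀ s → cutFactor X (true ∷ᵛ S) (fs s) fz ≡ 1ℚ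
    factor s with X (fs s) ∧ X fz | S s
    ... | false | _     = refl
    ... | true  | true  = refl
    ... | true  | false = refl

  firstRow-out : {n : ℕ} (X : VertexSet (suc n)) (S : VertexSet n) → firstRow X (false ∷ᵛ S) ≡ 1ℚ
  firstRow-out X S = prodFin-one factor
    where
    factor : ∀ t → cutFactor X (false ∷ᵛ S) fz (fs t) ≡ 1ℚ
    factor t with X fz ∧ X (fs t)
    ... | false = refl
    ... | true  = refl

  firstColumn-out : {n : ℕ} (X : VertexSet (suc n)) (S : VertexSet n) → X fz ≡ true →
    firstColumn X (false ∷ᵛ S) ≡ pow (1ℚ + u · y) (size (S ∩ tail X))
  firstColumn-out X S Xfz = trans (prodFin-cong factor) (prodFin-size (S ∩ tail X) (1ℚ + u · y))
    where
    factor : ∀ s → cutFactor X (false ∷ᵛ S) (fs s) fz ≡ (if S s ∧ X (fs s) then 1ℚ + u · y else 1ℚ)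
    factor s rewrite Xfz with X (fs s) | S s
    ... | true  | true  = refl
    ... | true  | false = refl
    ... | false | true  = refl
    ... | false | false = refl

  firstRow-absent : {n : ℕ} (X S : VertexSet (suc n)) → X fz ≡ false → firstRow X S ≡ 1ℚ
  firstRow-absent X S Xfz = prodFin-one (λ t → cong (λ b → if b ∧ X (fs t) then _ else 1ℚ) Xfz)

  firstColumn-absent : {n : ℕ} (X S : VertexSet (suc n)) → X fz ≡ false → firstColumn X S ≡ 1ℚ
  firstColumn-absent X S Xfz = prodFin-one factor
    where
    factor : ∀ s → cutFactor X S (fs s) fz ≡ 1ℚ
    factor s rewrite Xfz with X (fs s)
    ... | true  = refl
    ... | false = refl

  layerTerm : {n : ℕ} → VertexSet n → ℕ → VertexSet n → ℚ
  layerTerm X i S = (subsetSign X S · cutProduct X S) · δ (size (X ∖ S)) i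

  -- The coefficient of a_i in the source expansion of X: the sets S with |X ∖ S| = i.
  layer : {n : ℕ} → VertexSet n → ℕ → ℚ
  layer {n} X i = sumOver (layerTerm X i) (vertexSets n)

  layerTerm-∷ : {n : ℕ} (X : VertexSet (suc n)) (b : Bool) (S : VertexSet n) (i : ℕ) →
    layerTerm X i (b ∷ᵛ S)
      ≡ (memberSign (X fz) b · (firstRow X (b ∷ᵛ S) · firstColumn X (b ∷ᵛ S)))
        · ((subsetSign (tail X) S · cutProduct (tail X) S) · δ (size (X ∖ (b ∷ᵛ S))) i)
  layerTerm-∷ X b S i = trans
    (cong (λ c → (memberSign (X fz) b · subsetSign (tail X) S · c) · δ (size (X ∖ (b ∷ᵛ S))) i) (cutProduct-suc X (b ∷ᵛ S)))
    (solve 5 (λ m s r p d → (m :* s :* (r :* p)) :* d := (m :* r) :* ((s :* p) :* d)) refl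
       (memberSign (X fz) b) (subsetSign (tail X) S) (firstRow X (b ∷ᵛ S) · firstColumn X (b ∷ᵛ S))
       (cutProduct (tail X) S) (δ (size (X ∖ (b ∷ᵛ S))) i))

  layerTerm-in-in : {n : ℕ} (X : VertexSet (suc n)) (S : VertexSet n) (i : ℕ) → X fz ≡ true →
    layerTerm X i (true ∷ᵛ S) ≡ - pow (1ℚ + y) i · layerTerm (tail X) i S
  layerTerm-in-in X S i Xfz = begin
      layerTerm X i (true ∷ᵛ S)
    ≡⟨ layerTerm-∷ X true S i ⟩
      (memberSign (X fz) true · (firstRow X (true ∷ᵛ S) · firstColumn X (true ∷ᵛ S))) · (P · δ (size (X ∖ (true ∷ᵛ S))) i)
    ≡⟨ cong₂ (λ m r → (m · (r · firstColumn X (true ∷ᵛ S))) · (P · δ (size (X ∖ (true ∷ᵛ S))) i))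
         (cong (λ b → memberSign b true) Xfz) (firstRow-in X S Xfz) ⟩
      (- 1ℚ · (pow (1ℚ + y) c · firstColumn X (true ∷ᵛ S))) · (P · δ (size (X ∖ (true ∷ᵛ S))) i)
    ≡⟨ cong₂ (λ col k → (- 1ℚ · (pow (1ℚ + y) c · col)) · (P · δ k i))
         (firstColumn-in X S) (cong (λ b → (if b then 1 else 0) ℕ.+ c) (∧-zeroʳ (X fz))) ⟩
      (- 1ℚ · (pow (1ℚ + y) c · 1ℚ)) · (P · δ c i)
    ≡⟨ solve 2 (λ p l → (:- con 1ℚ :* (p :* con 1ℚ)) :* l := :- (p :* l)) refl (pow (1ℚ + y) c) (P · δ c i) ⟩
      - (pow (1ℚ + y) c · (P · δ c i))
    ≡⟨ cong -_ (δ-subst (pow (1ℚ + y)) P c i) ⟩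
      - (pow (1ℚ + y) i · (P · δ c i))
    ≡⟨ ℚ.neg-distribˡ-* (pow (1ℚ + y) i) _ ⟩
      - pow (1ℚ + y) i · layerTerm (tail X) i S ∎
    where
    open ≡-Reasoning
    P = subsetSign (tail X) S · cutProduct (tail X) S
    c = size (tail X ∖ S)

  layerTerm-in-out : {n : ℕ} (X : VertexSet (suc n)) (S : VertexSet n) (j : ℕ) → X fz ≡ true →
    layerTerm X (suc j) (false ∷ᵛ S) ≡ pow (1ℚ + u · y) (size (tail X) ∸ j) · layerTerm (tail X) j S
  layerTerm-in-out X S j Xfz = begin
      layerTerm X (suc j) (false ∷ᵛ S)
    ≡⟨ layerTerm-∷ X false S (suc j) ⟩
      (1ℚ · (firstRow X (false ∷ᵛ S) · firstColumn X (false ∷ᵛ S))) · (P · δ (size (X ∖ (false ∷ᵛ S))) (suc j))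
    ≡⟨ cong₂ (λ r col → (1ℚ · (r · col)) · (P · δ (size (X ∖ (false ∷ᵛ S))) (suc j)))
         (firstRow-out X S) (firstColumn-out X S Xfz) ⟩
      (1ℚ · (1ℚ · pow (1ℚ + u · y) shared)) · (P · δ (size (X ∖ (false ∷ᵛ S))) (suc j))
    ≡⟨ cong₂ (λ k b → (1ℚ · (1ℚ · pow (1ℚ + u · y) k)) · (P · δ ((if b ∧ true then 1 else 0) ℕ.+ c) (suc j)))
         shared≡ Xfz ⟩
      (1ℚ · (1ℚ · pow (1ℚ + u · y) (size (tail X) ∸ c))) · (P · δ c j)
    ≡⟨ cong (_· (P · δ c j)) (trans (ℚ.*-identityˡ _) (ℚ.*-identityˡ (pow (1ℚ + u · y) (size (tail X) ∸ c)))) ⟩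
      pow (1ℚ + u · y) (size (tail X) ∸ c) · (P · δ c j)
    ≡⟨ δ-subst (λ k → pow (1ℚ + u · y) (size (tail X) ∸ k)) P c j ⟩
      pow (1ℚ + u · y) (size (tail X) ∸ j) · layerTerm (tail X) j S ∎
    where
    open ≡-Reasoning
    P = subsetSign (tail X) S · cutProduct (tail X) S
    c = size (tail X ∖ S)
    shared = size (S ∩ tail X)
    shared≡ : shared ≡ size (tail X) ∸ c
    shared≡ = sym (trans (cong (_∸ c) (sym (size-∩+size-∖ S (tail X)))) (ℕ.m+n∸n≡m shared c))

  layerTerm-in-out-0 : {n : ℕ} (X : VertexSet (suc n)) (S : VertexSet n) → X fz ≡ true →
    layerTerm X 0 (false ∷ᵛ S) ≡ 0ℚ
  layerTerm-in-out-0 X S Xfz =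
    trans (cong (λ b → (subsetSign X (false ∷ᵛ S) · cutProduct X (false ∷ᵛ S)) · δ ((if b ∧ true then 1 else 0) ℕ.+ size (tail X ∖ S)) 0) Xfz)
          (ℚ.*-zeroʳ (subsetSign X (false ∷ᵛ S) · cutProduct X (false ∷ᵛ S)))

  layerTerm-out-in : {n : ℕ} (X : VertexSet (suc n)) (S : VertexSet n) (i : ℕ) → X fz ≡ false →
    layerTerm X i (true ∷ᵛ S) ≡ 0ℚ
  layerTerm-out-in X S i Xfz = begin
      layerTerm X i (true ∷ᵛ S)
    ≡⟨ layerTerm-∷ X true S i ⟩
      (memberSign (X fz) true · R) · L
    ≡⟨ cong (λ b → (memberSign b true · R) · L) Xfz ⟩
      (0ℚ · R) · L
    ≡⟨ solve 2 (λ r l → (con 0ℚ :* r) :* l := con 0ℚ) refl R L ⟩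
      0ℚ ∎
    where
    open ≡-Reasoning
    R = firstRow X (true ∷ᵛ S) · firstColumn X (true ∷ᵛ S)
    L = (subsetSign (tail X) S · cutProduct (tail X) S) · δ (size (X ∖ (true ∷ᵛ S))) i

  layerTerm-out-out : {n : ℕ} (X : VertexSet (suc n)) (S : VertexSet n) (i : ℕ) → X fz ≡ false →
    layerTerm X i (false ∷ᵛ S) ≡ layerTerm (tail X) i S
  layerTerm-out-out X S i Xfz = begin
      layerTerm X i (false ∷ᵛ S)
    ≡⟨ layerTerm-∷ X false S i ⟩
      (1ℚ · (firstRow X (false ∷ᵛ S) · firstColumn X (false ∷ᵛ S))) · (P · δ (size (X ∖ (false ∷ᵛ S))) i)
    ≡⟨ cong₂ (λ r col → (1ℚ · (r · col)) · (P · δ (size (X ∖ (false ∷ᵛ S))) i))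
         (firstRow-absent X (false ∷ᵛ S) Xfz) (firstColumn-absent X (false ∷ᵛ S) Xfz) ⟩
      (1ℚ · (1ℚ · 1ℚ)) · (P · δ (size (X ∖ (false ∷ᵛ S))) i)
    ≡⟨ cong (λ b → (1ℚ · (1ℚ · 1ℚ)) · (P · δ ((if b ∧ true then 1 else 0) ℕ.+ size (tail X ∖ S)) i)) Xfz ⟩
      (1ℚ · (1ℚ · 1ℚ)) · layerTerm (tail X) i S
    ≡⟨ ℚ.*-identityˡ _ ⟩
      layerTerm (tail X) i S ∎
    where
    open ≡-Reasoning
    P = subsetSign (tail X) S · cutProduct (tail X) S

  coefficient : ℕ → ℕ → ℚ
  coefficient zero    zero    = 1ℚ
  coefficient zero    (suc i) = 0ℚ
  coefficient (suc m) zero    = - coefficient m 0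
  coefficient (suc m) (suc j) = - (pow (1ℚ + y) (suc j) · coefficient m (suc j)) + pow (1ℚ + u · y) (m ∸ j) · coefficient m j

  layer-in-0 : {n : ℕ} (X : VertexSet (suc n)) → X fz ≡ true → layer X 0 ≡ - layer (tail X) 0
  layer-in-0 {n} X Xfz = begin
      layer X 0
    ≡⟨ sumOver-vertexSets-suc (layerTerm X 0) ⟩
      sumOver (layerTerm X 0 ∘ (true ∷ᵛ_)) (vertexSets n) + sumOver (layerTerm X 0 ∘ (false ∷ᵛ_)) (vertexSets n)
    ≡⟨ cong₂ _+_ (trans (sumOver-cong (λ S → layerTerm-in-in X S 0 Xfz) (vertexSets n)) (sumOver-*ˡ (- 1ℚ) (layerTerm (tail X) 0) (vertexSets n)))
                 (trans (sumOver-cong (λ S → layerTerm-in-out-0 X S Xfz) (vertexSets n)) (sumOver-0 (vertexSets n))) ⟩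
      - 1ℚ · layer (tail X) 0 + 0ℚ
    ≡⟨ solve 1 (λ g → :- con 1ℚ :* g :+ con 0ℚ := :- g) refl (layer (tail X) 0) ⟩
      - layer (tail X) 0 ∎
    where open ≡-Reasoning

  layer-in-suc : {n : ℕ} (X : VertexSet (suc n)) → X fz ≡ true → (j : ℕ) →
    layer X (suc j) ≡ - (pow (1ℚ + y) (suc j) · layer (tail X) (suc j)) + pow (1ℚ + u · y) (size (tail X) ∸ j) · layer (tail X) j
  layer-in-suc {n} X Xfz j = begin
      layer X (suc j)
    ≡⟨ sumOver-vertexSets-suc (layerTerm X (suc j)) ⟩
      sumOver (layerTerm X (suc j) ∘ (true ∷ᵛ_)) (vertexSets n) + sumOver (layerTerm X (suc j) ∘ (false ∷ᵛ_)) (vertexSets n)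
    ≡⟨ cong₂ _+_
         (trans (sumOver-cong (λ S → layerTerm-in-in X S (suc j) Xfz) (vertexSets n))
                (sumOver-*ˡ (- pow (1ℚ + y) (suc j)) (layerTerm (tail X) (suc j)) (vertexSets n)))
         (trans (sumOver-cong (λ S → layerTerm-in-out X S j Xfz) (vertexSets n))
                (sumOver-*ˡ (pow (1ℚ + u · y) (size (tail X) ∸ j)) (layerTerm (tail X) j) (vertexSets n))) ⟩
      - pow (1ℚ + y) (suc j) · layer (tail X) (suc j) + pow (1ℚ + u · y) (size (tail X) ∸ j) · layer (tail X) j
    ≡⟨ cong (_+ pow (1ℚ + u · y) (size (tail X) ∸ j) · layer (tail X) j)
         (sym (ℚ.neg-distribˡ-* (pow (1ℚ + y) (suc j)) (layer (tail X) (suc j)))) ⟩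
      - (pow (1ℚ + y) (suc j) · layer (tail X) (suc j)) + pow (1ℚ + u · y) (size (tail X) ∸ j) · layer (tail X) j ∎
    where open ≡-Reasoning

  layer-out : {n : ℕ} (X : VertexSet (suc n)) → X fz ≡ false → (i : ℕ) → layer X i ≡ layer (tail X) i
  layer-out {n} X Xfz i = begin
      layer X i
    ≡⟨ sumOver-vertexSets-suc (layerTerm X i) ⟩
      sumOver (layerTerm X i ∘ (true ∷ᵛ_)) (vertexSets n) + sumOver (layerTerm X i ∘ (false ∷ᵛ_)) (vertexSets n)
    ≡⟨ cong₂ _+_ (trans (sumOver-cong (λ S → layerTerm-out-in X S i Xfz) (vertexSets n)) (sumOver-0 (vertexSets n)))
                 (sumOver-cong (λ S → layerTerm-out-out X S i Xfz) (vertexSets n)) ⟩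
      0ℚ + layer (tail X) i
    ≡⟨ ℚ.+-identityˡ _ ⟩
      layer (tail X) i ∎
    where open ≡-Reasoning

  layer≡coefficient : {n : ℕ} (X : VertexSet n) (i : ℕ) → layer X i ≡ coefficient (size X) i
  layer≡coefficient {zero}  X zero    = refl
  layer≡coefficient {zero}  X (suc i) = refl
  layer≡coefficient {suc n} X i = byLeastVertex (X fz) refl i
    where
    size≡ : ∀ {b} → X fz ≡ b → size X ≡ (if b then 1 else 0) ℕ.+ size (tail X)
    size≡ Xfz = cong (λ b → (if b then 1 else 0) ℕ.+ size (tail X)) Xfz
    byLeastVertex : (b : Bool) → X fz ≡ b → (i : ℕ) → layer X i ≡ coefficient (size X) i
    byLeastVertex false Xfz i = trans (layer-out X Xfz i)
      (trans (layer≡coefficient (tail X) i) (cong (λ m → coefficient m i) (sym (size≡ Xfz))))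
    byLeastVertex true Xfz zero = trans (layer-in-0 X Xfz)
      (trans (cong -_ (layer≡coefficient (tail X) 0)) (cong (λ m → coefficient m 0) (sym (size≡ Xfz))))
    byLeastVertex true Xfz (suc j) = trans (layer-in-suc X Xfz j) (trans
      (cong₂ (λ g h → - (pow (1ℚ + y) (suc j) · g) + pow (1ℚ + u · y) (size (tail X) ∸ j) · h)
             (layer≡coefficient (tail X) (suc j)) (layer≡coefficient (tail X) j))
      (cong (λ m → coefficient m (suc j)) (sym (size≡ Xfz))))

-- The recursion for a(X)

module _ (u y : ℚ) where

  sumOver-layers : {n : ℕ} (X : VertexSet n) (g : ℕ → ℚ) →
    sumOver (λ S → subsetSign X S · (cutWeight u y X S · g (size (X ∖ S)))) (vertexSets n)
      ≡ sumBelow (suc n) (λ i → g i · layer u y X i)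
  sumOver-layers {n} X g = sym (begin
      sumBelow (suc n) (λ i → g i · layer u y X i)
    ≡⟨ sumOver-cong (λ i → sym (sumOver-*ˡ (g i) (layerTerm u y X i) (vertexSets n))) (upTo (suc n)) ⟩
      sumBelow (suc n) (λ i → sumOver (λ S → g i · layerTerm u y X i S) (vertexSets n))
    ≡⟨ sumOver-comm (λ i S → g i · layerTerm u y X i S) (upTo (suc n)) (vertexSets n) ⟩
      sumOver (λ S → sumBelow (suc n) (λ i → g i · layerTerm u y X i S)) (vertexSets n)
    ≡⟨ sumOver-cong collapse (vertexSets n) ⟩
      sumOver (λ S → subsetSign X S · (cutWeight u y X S · g (size (X ∖ S)))) (vertexSets n) ∎)
    where
    open ≡-Reasoning
    collapse : ∀ S → sumBelow (suc n) (λ i → g i · layerTerm u y X i S) ≡ subsetSign X S · (cutWeight u y X S · g (size (X ∖ S)))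
    collapse S = begin
        sumBelow (suc n) (λ i → g i · ((subsetSign X S · cutProduct u y X S) · δ c i))
      ≡⟨ sumOver-cong (λ i → solve 3 (λ a p d → a :* (p :* d) := p :* (d :* a)) refl (g i) (subsetSign X S · cutProduct u y X S) (δ c i)) (upTo (suc n)) ⟩
        sumBelow (suc n) (λ i → (subsetSign X S · cutProduct u y X S) · (δ c i · g i))
      ≡⟨ sumOver-*ˡ (subsetSign X S · cutProduct u y X S) (λ i → δ c i · g i) (upTo (suc n)) ⟩
        (subsetSign X S · cutProduct u y X S) · sumBelow (suc n) (λ i → δ c i · g i)
      ≡⟨ cong₂ (λ p s → (subsetSign X S · p) · s) (sym (cutWeight≡cutProduct u y X S))
           (sumBelow-δ (suc n) c (ℕ.s≤s (ℕ.≤-trans (size-∖-≤ X S) (size-≤ X))) g) ⟩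
        (subsetSign X S · cutWeight u y X S) · g c
      ≡⟨ ℚ.*-assoc (subsetSign X S) (cutWeight u y X S) (g c) ⟩
        subsetSign X S · (cutWeight u y X S · g c) ∎
      where c = size (X ∖ S)

  coefficient-above : (m i : ℕ) → m < i → coefficient u y m i ≡ 0ℚ
  coefficient-above zero    (suc i) _ = refl
  coefficient-above (suc m) (suc i) (ℕ.s≤s m<i)
    rewrite coefficient-above m (suc i) (ℕ.m≤n⇒m≤1+n m<i) | coefficient-above m i m<i =
    solve 2 (λ p q → :- (p :* con 0ℚ) :+ q :* con 0ℚ := con 0ℚ) refl (pow (1ℚ + y) (suc i)) (pow (1ℚ + u · y) (m ∸ i))

  coefficient-diagonal : (m : ℕ) → coefficient u y m m ≡ 1ℚ
  coefficient-diagonal zero    = refl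
  coefficient-diagonal (suc m)
    rewrite coefficient-above m (suc m) (ℕ.n<1+n m) | coefficient-diagonal m | ℕ.n∸n≡0 m =
    solve 1 (λ p → :- (p :* con 0ℚ) :+ con 1ℚ :* con 1ℚ := con 1ℚ) refl (pow (1ℚ + y) (suc m))

  aOn-empty : {n : ℕ} (X : VertexSet n) → size X ≡ 0 → aOn u y X ≡ 1ℚ
  aOn-empty {n} X empty = trans
    (cong (λ L → sumOver (digraphWeight u y) (subsets L)) (filterᵇ-none (within X) (allEdges n) (λ e → cong (_∧ X (proj₂ e)) (size≡0 X empty (proj₁ e)))))
    (cong (λ b → (if b then 1ℚ · 1ℚ else 0ℚ) + 0ℚ) (acyclic-[] {n}))

  aOn-cong : {n : ℕ} {X X′ : VertexSet n} → (∀ v → X v ≡ X′ v) → aOn u y X ≡ aOn u y X′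
  aOn-cong {n} X≗X′ = cong (λ L → sumOver (digraphWeight u y) (subsets L))
    (filterᵇ-cong (λ e → cong₂ _∧_ (X≗X′ (proj₁ e)) (X≗X′ (proj₂ e))) (allEdges n))

  a≡aOn : (n : ℕ) → a n u y ≡ aOn {n} u y (λ _ → true)
  a≡aOn n = cong (λ L → sumOver (digraphWeight u y) (subsets L)) (sym (filterᵇ-all _ (allEdges n) (λ _ → refl)))

  -- The source expansion of X, regrouped by layers.  Both a(X ∖ S) and the layers are read
  -- through g, with g i = a_i below m = |X| and g m = a(X): the only layer where X ∖ S = X.
  aOn-balance : {n : ℕ} (X : VertexSet n) (m : ℕ) → size X ≡ suc m →
    (∀ {n′} (X′ : VertexSet n′) → size X′ < suc m → aOn u y X′ ≡ a (size X′) u y) →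
    sumBelow (suc m) (λ i → a i u y · coefficient u y (suc m) i) + aOn u y X ≡ 0ℚ
  aOn-balance {n} X m sizeX smaller = begin
      sumBelow M (λ i → a i u y · coefficient u y M i) + aOn u y X
    ≡⟨ cong₂ _+_ (sumBelow-cong M (λ i i<M → cong (_· coefficient u y M i) (sym (g-below i i<M))))
                 (sym (trans (cong₂ _·_ g-top (coefficient-diagonal M)) (ℚ.*-identityʳ (aOn u y X)))) ⟩
      sumBelow M G + G M
    ≡⟨ sym (sumBelow-snoc M G) ⟩
      sumBelow (suc M) G
    ≡⟨ sym (sumBelow-+-vanishing (suc M) (n ∸ M) G
         (λ j → trans (cong (g (suc M ℕ.+ j) ·_) (coefficient-above M (suc M ℕ.+ j) (ℕ.s≤s (ℕ.m≤m+n M j))))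
                      (ℚ.*-zeroʳ (g (suc M ℕ.+ j))))) ⟩
      sumBelow (suc M ℕ.+ (n ∸ M)) G
    ≡⟨ cong (λ l → sumBelow (suc l) G) (ℕ.m+[n∸m]≡n (subst (_≤ n) sizeX (size-≤ X))) ⟩
      sumBelow (suc n) G
    ≡⟨ sumBelow-cong (suc n) (λ i _ → cong (g i ·_) (sym (trans (layer≡coefficient u y X i) (cong (λ k → coefficient u y k i) sizeX)))) ⟩
      sumBelow (suc n) (λ i → g i · layer u y X i)
    ≡⟨ sym (sumOver-layers X g) ⟩
      sumOver (λ S → subsetSign X S · (cutWeight u y X S · g (size (X ∖ S)))) (vertexSets n)
    ≡⟨ sumOver-cong (λ S → cong (λ z → subsetSign X S · (cutWeight u y X S · z)) (sym (aOn-∖ S))) (vertexSets n) ⟩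
      sumOver (λ S → subsetSign X S · (cutWeight u y X S · aOn u y (X ∖ S))) (vertexSets n)
    ≡⟨ sourceExpansion u y X (proj₁ (size≡suc X sizeX)) (proj₂ (size≡suc X sizeX)) ⟩
      0ℚ ∎
    where
    open ≡-Reasoning
    M = suc m
    g : ℕ → ℚ
    g i = if does (i ℕ.≟ M) then aOn u y X else a i u y
    G : ℕ → ℚ
    G i = g i · coefficient u y M i
    g-below : ∀ i → i < M → g i ≡ a i u y
    g-below i i<M = cong (λ b → if b then aOn u y X else a i u y) (dec-false (i ℕ.≟ M) (ℕ.<⇒≢ i<M))
    g-top : g M ≡ aOn u y X
    g-top = cong (λ b → if b then aOn u y X else a M u y) (dec-true (M ℕ.≟ M) refl)
    aOn-∖ : ∀ S → aOn u y (X ∖ S) ≡ g (size (X ∖ S))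
    aOn-∖ S with ℕ.m≤n⇒m<n∨m≡n (subst (size (X ∖ S) ≤_) sizeX (size-∖-≤ X S))
    ... | inj₁ lt = trans (smaller (X ∖ S) lt) (sym (g-below _ lt))
    ... | inj₂ eq = trans (aOn-cong (∖-size X S (trans eq (sym sizeX)))) (sym (trans (cong g eq) g-top))

  aOn-recursion : {n : ℕ} (X : VertexSet n) (m : ℕ) → size X ≡ suc m →
    (∀ {n′} (X′ : VertexSet n′) → size X′ < suc m → aOn u y X′ ≡ a (size X′) u y) →
    aOn u y X ≡ sumBelow (suc m) (λ i → - (a i u y · coefficient u y (suc m) i))
  aOn-recursion X m sizeX smaller = begin
      aOn u y X
    ≡⟨ solve 2 (λ s x → x := (s :+ x) :+ :- s) refl total (aOn u y X) ⟩
      (total + aOn u y X) + - total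
    ≡⟨ cong (_+ - total) (aOn-balance X m sizeX smaller) ⟩
      0ℚ + - total
    ≡⟨ ℚ.+-identityˡ (- total) ⟩
      - total
    ≡⟨ sym (sumOver-neg (λ i → a i u y · coefficient u y (suc m) i) (upTo (suc m))) ⟩
      sumBelow (suc m) (λ i → - (a i u y · coefficient u y (suc m) i)) ∎
    where
    open ≡-Reasoning
    total = sumBelow (suc m) (λ i → a i u y · coefficient u y (suc m) i)

  aOn≡a : {n : ℕ} (X : VertexSet n) → aOn u y X ≡ a (size X) u y
  aOn≡a X = <-rec P step (size X) X refl
    where
    P : ℕ → Set
    P j = ∀ {n} (X : VertexSet n) → size X ≡ j → aOn u y X ≡ a j u y
    step : ∀ j → (∀ {i} → i < j → P i) → P j
    step zero    _       X empty = trans (aOn-empty X empty) (sym (trans (a≡aOn 0) (aOn-empty {0} (λ _ → true) refl)))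
    step (suc m) smaller X sizeX = trans (aOn-recursion X m sizeX IH)
      (sym (trans (a≡aOn (suc m)) (aOn-recursion {suc m} (λ _ → true) m (size-full (suc m)) IH)))
      where
      IH : ∀ {n′} (X′ : VertexSet n′) → size X′ < suc m → aOn u y X′ ≡ a (size X′) u y
      IH X′ lt = smaller lt X′ refl

  a-recursion : (m : ℕ) → a (suc m) u y ≡ sumBelow (suc m) (λ i → - (a i u y · coefficient u y (suc m) i))
  a-recursion m = trans (a≡aOn (suc m)) (aOn-recursion {suc m} (λ _ → true) m (size-full (suc m)) (λ X′ _ → aOn≡a X′))

-- Gaussian binomials

pow-+ : (x : ℚ) (a b : ℕ) → pow x (a ℕ.+ b) ≡ pow x a · pow x b
pow-+ x zero    b = sym (ℚ.*-identityˡ _)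
pow-+ x (suc a) b = trans (cong (x ·_) (pow-+ x a b)) (sym (ℚ.*-assoc x _ _))

pow-· : (x z : ℚ) (k : ℕ) → pow (x · z) k ≡ pow x k · pow z k
pow-· x z zero    = refl
pow-· x z (suc k) = trans (cong (x · z ·_) (pow-· x z k))
  (solve 4 (λ x z p r → (x :* z) :* (p :* r) := (x :* p) :* (z :* r)) refl x z (pow x k) (pow z k))

div-·-cancel : (x d : ℚ) → d ≢ 0ℚ → div x d · d ≡ x
div-·-cancel x d d≢0 with d ≟ℚ 0ℚ
... | yes d≡0 = ⊥-elim (d≢0 d≡0)
... | no d≢0′ = begin
    x · (1/ d) · d   ≡⟨ ℚ.*-assoc x _ d ⟩
    x · ((1/ d) · d) ≡⟨ cong (x ·_) (ℚ.*-inverseˡ d) ⟩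
    x · 1ℚ          ≡⟨ ℚ.*-identityʳ x ⟩
    x ∎
  where
  open ≡-Reasoning
  instance _ = ≢-nonZero d≢0′

div-unique : (x d z : ℚ) → d ≢ 0ℚ → z · d ≡ x → div x d ≡ z
div-unique x d z d≢0 z·d≡x with d ≟ℚ 0ℚ
... | yes d≡0 = ⊥-elim (d≢0 d≡0)
... | no d≢0′ = begin
    x · (1/ d)       ≡⟨ cong (_· (1/ d)) (sym z·d≡x) ⟩
    (z · d) · (1/ d) ≡⟨ ℚ.*-assoc z d _ ⟩
    z · (d · (1/ d)) ≡⟨ cong (z ·_) (ℚ.*-inverseʳ d) ⟩
    z · 1ℚ          ≡⟨ ℚ.*-identityʳ z ⟩
    z ∎
  where
  open ≡-Reasoning
  instance _ = ≢-nonZero d≢0′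

·-≢0 : (a b : ℚ) → a ≢ 0ℚ → b ≢ 0ℚ → a · b ≢ 0ℚ
·-≢0 a b a≢0 b≢0 a·b≡0 = b≢0 (begin
    b                 ≡⟨ sym (ℚ.*-identityˡ b) ⟩
    1ℚ · b            ≡⟨ cong (_· b) (sym (ℚ.*-inverseˡ a)) ⟩
    ((1/ a) · a) · b  ≡⟨ ℚ.*-assoc (1/ a) a b ⟩
    (1/ a) · (a · b)  ≡⟨ cong ((1/ a) ·_) a·b≡0 ⟩
    (1/ a) · 0ℚ       ≡⟨ ℚ.*-zeroʳ (1/ a) ⟩
    0ℚ ∎)
  where
  open ≡-Reasoning
  instance _ = ≢-nonZero a≢0

∸-suc : {m j : ℕ} → j < m → m ∸ j ≡ suc (m ∸ suc j)
∸-suc j<m = ℕ.+-∸-assoc 1 j<m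

module _ (q : ℚ) where

  qint-suc : (k : ℕ) → qint q (suc k) ≡ 1ℚ + q · qint q k
  qint-suc k = trans (sumBelow-suc k (pow q)) (cong (1ℚ +_) (sumOver-*ˡ q (pow q) (upTo k)))

  qint-+ : (a b : ℕ) → qint q (a ℕ.+ b) ≡ qint q a + pow q a · qint q b
  qint-+ zero    b = solve 1 (λ z → z := con 0ℚ :+ con 1ℚ :* z) refl (qint q b)
  qint-+ (suc a) b rewrite qint-suc (a ℕ.+ b) | qint-+ a b | qint-suc a =
    solve 4 (λ q A p B → con 1ℚ :+ q :* (A :+ p :* B) := (con 1ℚ :+ q :* A) :+ (q :* p) :* B) refl q (qint q a) (pow q a) (qint q b)

  -- Gaussian binomials by the q-Pascal rule; they agree with qbinom wherever no q-factorial vanishes.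
  qChoose : ℕ → ℕ → ℚ
  qChoose zero    zero    = 1ℚ
  qChoose zero    (suc i) = 0ℚ
  qChoose (suc m) zero    = 1ℚ
  qChoose (suc m) (suc i) = qChoose m (suc i) + pow q (m ∸ i) · qChoose m i

  qChoose-above : (m i : ℕ) → m < i → qChoose m i ≡ 0ℚ
  qChoose-above zero    (suc i) _ = refl
  qChoose-above (suc m) (suc i) (ℕ.s≤s m<i) rewrite qChoose-above m (suc i) (ℕ.m≤n⇒m≤1+n m<i) | qChoose-above m i m<i =
    solve 1 (λ p → con 0ℚ :+ p :* con 0ℚ := con 0ℚ) refl (pow q (m ∸ i))

  qChoose-0 : (m : ℕ) → qChoose m 0 ≡ 1ℚ
  qChoose-0 zero    = refl
  qChoose-0 (suc m) = refl

  qChoose-diagonal : (m : ℕ) → qChoose m m ≡ 1ℚ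
  qChoose-diagonal zero    = refl
  qChoose-diagonal (suc m) rewrite qChoose-above m (suc m) (ℕ.n<1+n m) | qChoose-diagonal m | ℕ.n∸n≡0 m =
    solve 0 (con 0ℚ :+ con 1ℚ :* con 1ℚ := con 1ℚ) refl

  qChoose-qfact : (m i : ℕ) → i ≤ m → qChoose m i · (qfact q i · qfact q (m ∸ i)) ≡ qfact q m
  qChoose-qfact m zero _ rewrite qChoose-0 m = solve 1 (λ f → con 1ℚ :* (con 1ℚ :* f) := f) refl (qfact q m)
  qChoose-qfact (suc m) (suc i) (ℕ.s≤s i≤m) with ℕ.m≤n⇒m<n∨m≡n i≤m
  ... | inj₂ refl = trans (cong₂ (λ c k → c · (qfact q (suc i) · qfact q k)) (qChoose-diagonal (suc i)) (ℕ.n∸n≡0 i))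
    (solve 1 (λ f → con 1ℚ :* (f :* con 1ℚ) := f) refl (qfact q (suc i)))
  ... | inj₁ i<m = begin
      (qChoose m (suc i) + pow q (m ∸ i) · qChoose m i) · ((qint q (suc i) · qfact q i) · qfact q (m ∸ i))
    ≡⟨ cong (λ k → (qChoose m (suc i) + pow q (m ∸ i) · qChoose m i) · ((qint q (suc i) · qfact q i) · qfact q k)) (∸-suc i<m) ⟩
      (qChoose m (suc i) + pow q (m ∸ i) · qChoose m i) · ((qint q (suc i) · qfact q i) · (qint q (suc r) · qfact q r))
    ≡⟨ solve 7 (λ A B p Ii fi Ie fe → (A :+ p :* B) :* ((Ii :* fi) :* (Ie :* fe)) :=
                  (A :* ((Ii :* fi) :* fe)) :* Ie :+ p :* Ii :* (B :* (fi :* (Ie :* fe)))) refl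
         (qChoose m (suc i)) (qChoose m i) (pow q (m ∸ i)) (qint q (suc i)) (qfact q i) (qint q (suc r)) (qfact q r) ⟩
      (qChoose m (suc i) · (qfact q (suc i) · qfact q r)) · qint q (suc r)
        + pow q (m ∸ i) · qint q (suc i) · (qChoose m i · (qfact q i · qfact q (suc r)))
    ≡⟨ cong₂ (λ a b → a · qint q (suc r) + pow q (m ∸ i) · qint q (suc i) · b) (qChoose-qfact m (suc i) i<m)
         (trans (cong (λ k → qChoose m i · (qfact q i · qfact q k)) (sym (∸-suc i<m))) (qChoose-qfact m i i≤m)) ⟩
      qfact q m · qint q (suc r) + pow q (m ∸ i) · qint q (suc i) · qfact q m
    ≡⟨ cong (λ k → qfact q m · qint q k + pow q (m ∸ i) · qint q (suc i) · qfact q m) (sym (∸-suc i<m)) ⟩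
      qfact q m · qint q (m ∸ i) + pow q (m ∸ i) · qint q (suc i) · qfact q m
    ≡⟨ solve 4 (λ f A p B → f :* A :+ p :* B :* f := (A :+ p :* B) :* f) refl (qfact q m) (qint q (m ∸ i)) (pow q (m ∸ i)) (qint q (suc i)) ⟩
      (qint q (m ∸ i) + pow q (m ∸ i) · qint q (suc i)) · qfact q m
    ≡⟨ cong (_· qfact q m) (sym (qint-+ (m ∸ i) (suc i))) ⟩
      qint q (m ∸ i ℕ.+ suc i) · qfact q m
    ≡⟨ cong (λ k → qint q k · qfact q m) (trans (ℕ.+-suc (m ∸ i) i) (cong suc (ℕ.m∸n+n≡m i≤m))) ⟩
      qfact q (suc m) ∎
    where
    open ≡-Reasoning
    r = m ∸ suc i

signed-pascal : (s a b r p₁ p₂ p₃ p₄ w : ℚ) → p₁ · p₂ ≡ w → p₃ · p₄ ≡ w →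
  - (p₁ · (s · a · p₂)) + (r · p₃) · ((- 1ℚ · s) · b · p₄) ≡ (- 1ℚ · s) · (a + r · b) · w
signed-pascal s a b r p₁ p₂ p₃ p₄ w p₁p₂≡w p₃p₄≡w = begin
    - (p₁ · (s · a · p₂)) + (r · p₃) · ((- 1ℚ · s) · b · p₄)
  ≡⟨ solve 8 (λ s a b r p₁ p₂ p₃ p₄ → :- (p₁ :* (s :* a :* p₂)) :+ (r :* p₃) :* ((:- con 1ℚ :* s) :* b :* p₄)
                := (:- (s :* a)) :* (p₁ :* p₂) :+ (:- (s :* b :* r)) :* (p₃ :* p₄)) refl s a b r p₁ p₂ p₃ p₄ ⟩
    (- (s · a)) · (p₁ · p₂) + (- (s · b · r)) · (p₃ · p₄)
  ≡⟨ cong₂ (λ x z → (- (s · a)) · x + (- (s · b · r)) · z) p₁p₂≡w p₃p₄≡w ⟩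
    (- (s · a)) · w + (- (s · b · r)) · w
  ≡⟨ solve 5 (λ s a b r w → (:- (s :* a)) :* w :+ (:- (s :* b :* r)) :* w := (:- con 1ℚ :* s) :* (a :+ r :* b) :* w) refl s a b r w ⟩
    (- 1ℚ · s) · (a + r · b) · w ∎
  where open ≡-Reasoning

module _ (u y q : ℚ) (q[1+y]≡1+uy : q · (1ℚ + y) ≡ 1ℚ + u · y) where

  -- Writing 1 + u y = q (1 + y), the recursion of the coefficients becomes the q-Pascal rule.
  coefficient-closed : (m i : ℕ) → coefficient u y m i ≡ pow (- 1ℚ) (m ∸ i) · qChoose q m i · pow (1ℚ + y) (i * (m ∸ i))
  coefficient-closed zero    zero    = refl
  coefficient-closed zero    (suc i) = solve 1 (λ p → con 0ℚ := con 1ℚ :* con 0ℚ :* p) refl (pow (1ℚ + y) (suc i * 0))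
  coefficient-closed (suc m) zero rewrite coefficient-closed m 0 | qChoose-0 q m =
    solve 1 (λ s → :- (s :* con 1ℚ :* con 1ℚ) := (:- con 1ℚ :* s) :* con 1ℚ :* con 1ℚ) refl (pow (- 1ℚ) m)
  coefficient-closed (suc m) (suc j) with ℕ.<-cmp j m
  ... | tri< j<m _ _ rewrite coefficient-closed m (suc j) | coefficient-closed m j | ∸-suc j<m =
    trans (cong (λ z → - (pow (1ℚ + y) (suc j) · (pow (- 1ℚ) r · qChoose q m (suc j) · pow (1ℚ + y) (suc j * r)))
                       + z · ((- 1ℚ · pow (- 1ℚ) r) · qChoose q m j · pow (1ℚ + y) (j * suc r)))
                (trans (cong (λ z → pow z (suc r)) (sym q[1+y]≡1+uy)) (pow-· q (1ℚ + y) (suc r))))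
          (signed-pascal (pow (- 1ℚ) r) (qChoose q m (suc j)) (qChoose q m j) (pow q (suc r))
             (pow (1ℚ + y) (suc j)) (pow (1ℚ + y) (suc j * r)) (pow (1ℚ + y) (suc r)) (pow (1ℚ + y) (j * suc r))
             (pow (1ℚ + y) (suc j * suc r))
             (trans (sym (pow-+ (1ℚ + y) (suc j) (suc j * r))) (cong (pow (1ℚ + y)) (sym (ℕ.*-suc (suc j) r))))
             (sym (pow-+ (1ℚ + y) (suc r) (j * suc r))))
    where r = m ∸ suc j
  ... | tri≈ _ refl _ rewrite coefficient-diagonal u y (suc j) | ℕ.n∸n≡0 j | qChoose-above q j (suc j) (ℕ.n<1+n j)
                            | qChoose-diagonal q j | ℕ.*-zeroʳ j = refl
  ... | tri> _ _ m<j rewrite coefficient-above u y (suc m) (suc j) (ℕ.s≤s m<j) | qChoose-above q m (suc j) (ℕ.m≤n⇒m≤1+n m<j)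
                           | qChoose-above q m j m<j =
    solve 3 (λ s p w → con 0ℚ := s :* (con 0ℚ :+ p :* con 0ℚ) :* w) refl (pow (- 1ℚ) (m ∸ j)) (pow q (m ∸ j)) (pow (1ℚ + y) (suc j * (m ∸ j)))

suc[∸1] : {a : ℕ} → 0 < a → suc (a ∸ 1) ≡ a
suc[∸1] {suc a} _ = refl

qbinom≡qChoose : (q : ℚ) (n i : ℕ) → i ≤ n → ((k : ℕ) → k ≤ n → qfact q k ≢ 0ℚ) → qbinom q n i ≡ qChoose q n i
qbinom≡qChoose q n i i≤n qfact≢0 = div-unique (qfact q n) (qfact q i · qfact q (n ∸ i)) (qChoose q n i)
  (·-≢0 _ _ (qfact≢0 i i≤n) (qfact≢0 (n ∸ i) (ℕ.m∸n≤m n i))) (qChoose-qfact q n i i≤n)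

corollary4p3 : (n : ℕ) → 1 ≤ n → (u y : ℚ) → 1ℚ + y ≢ 0ℚ
    → ((k : ℕ) → k ≤ n → qfact (qOf u y) k ≢ 0ℚ)
    → a n u y ≡ sumBelow n (λ i → pow (- 1ℚ) (n ∸ i ∸ 1) · qbinom (qOf u y) n i · pow (1ℚ + y) (i * (n ∸ i)) · a i u y)
corollary4p3 (suc m) _ u y 1+y≢0 qfact≢0 = trans (a-recursion u y m) (sumBelow-cong (suc m) term)
  where
  n = suc m
  q = qOf u y
  term : ∀ i → i < n → - (a i u y · coefficient u y n i)
                       ≡ pow (- 1ℚ) (n ∸ i ∸ 1) · qbinom q n i · pow (1ℚ + y) (i * (n ∸ i)) · a i u y
  term i i<n = begin
      - (a i u y · coefficient u y n i)
    ≡⟨ cong (λ c → - (a i u y · c)) (coefficient-closed u y q (div-·-cancel (1ℚ + u · y) (1ℚ + y) 1+y≢0) n i) ⟩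
      - (a i u y · (pow (- 1ℚ) (n ∸ i) · qChoose q n i · pow (1ℚ + y) (i * (n ∸ i))))
    ≡⟨ cong₂ (λ k b → - (a i u y · (pow (- 1ℚ) k · b · pow (1ℚ + y) (i * (n ∸ i)))))
         (sym (suc[∸1] (ℕ.m<n⇒0<n∸m i<n))) (sym (qbinom≡qChoose q n i (ℕ.<⇒≤ i<n) qfact≢0)) ⟩
      - (a i u y · (- 1ℚ · pow (- 1ℚ) (n ∸ i ∸ 1) · qbinom q n i · pow (1ℚ + y) (i * (n ∸ i))))
    ≡⟨ solve 4 (λ a s b w → :- (a :* ((:- con 1ℚ :* s) :* b :* w)) := s :* b :* w :* a) refl
         (a i u y) (pow (- 1ℚ) (n ∸ i ∸ 1)) (qbinom q n i) (pow (1ℚ + y) (i * (n ∸ i))) ⟩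
      pow (- 1ℚ) (n ∸ i ∸ 1) · qbinom q n i · pow (1ℚ + y) (i * (n ∸ i)) · a i u y ∎
    where open ≡-Reasoning
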